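{- Let $r\in\mathbb{N}$, let $a_1\in\mathbb{N}$ and $a_2,\dots,a_r\in\mathbb{N}_0$, and put $\mathbf{s}=(\{2\}^{a_1},1,\{2\}^{a_2},1,\dots,\{2\}^{a_r},1)$. Then \[ \zeta^\star(\mathbf{s})=\sum_{\mathbf{p}} 2^{\ell(\mathbf{p})}\zeta(\mathbf{p}), \] where $\mathbf{p}$ runs through all $2^{r-1}$ indices of the form $(2a_1+1)\circ(2a_2+1)\circ\cdots\circ(2a_r+1)$, each symbol $\circ$ being independently either the comma "," or the plus sign "$+$" (so that consecutive entries joined by $+$ are added into a single component).
   Context: $\mathbb{N}=\{1,2,\dots\}$, $\mathbb{N}_0=\mathbb{N}\cup\{0\}$. For a composition $\mathbf{s}=(s_1,\dots,s_\ell)$ of positive integers, $H_n(\mathbf{s})=\sum_{n\ge k_1>k_2>\cdots>k_\ell\ge1}\prod_{i=1}^\ell k_i^{ -s_i}$ and $H^\star_n(\mathbf{s})=\sum_{n\ge k_1\ge k_2\ge\cdots\ge k_\ell\ge1}\prod_{i=1}^\ell k_i^{ -s_i}$; when $s_1\ge2$, the multiple zeta value is $\zeta(\mathbf{s})=\lim_{n\to\infty}H_n(\mathbf{s})$ and the multiple zeta star value is $\zeta^\star(\mathbf{s})=\lim_{n\to\infty}H^\star_n(\mathbf{s})$. $\ell(\mathbf{p})$ denotes the number of components (depth) of $\mathbf{p}$. $\{2\}^a$ denotes the string $2,2,\dots,2$ ($a$ copies; empty if $a=0$). -}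

module Defs where

open import Data.Nat as ℕ using (ℕ; zero; suc)
open import Data.Nat.Properties using (m^n≢0)
open import Data.Integer using (+_)
open import Data.Rational using (ℚ; 0ℚ; 1ℚ; _+_; _*_; _/_)
open import Data.Bool using (Bool; true; false)
open import Data.List using (List; []; _∷_; [_]; _++_; replicate; map; concatMap)
open import Data.Vec using (Vec)
import Data.Vec as V
open import Data.Product using (_×_; _,_)

-- 1 / k^s for k = suc i (so k ≥ 1)
inv : ℕ → ℕ → ℚ
inv i s = (+ 1 / (suc i ℕ.^ s)) {{m^n≢0 (suc i) s}}

-- H n s = Σ_{n ≥ k₁ > k₂ > ... > k_ℓ ≥ 1} Π k_j^{-s_j}   (H n [] = 1)
H : ℕ → List ℕ → ℚ
H n [] = 1ℚ
H zero (s ∷ ss) = 0ℚ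
H (suc n) (s ∷ ss) = inv n s * H n ss + H n (s ∷ ss)
  -- term k₁ = n+1 (remaining k's ≤ n), plus terms with k₁ ≤ n

-- H⋆ n s = Σ_{n ≥ k₁ ≥ k₂ ≥ ... ≥ k_ℓ ≥ 1} Π k_j^{-s_j}   (H⋆ n [] = 1)
Hstar : ℕ → List ℕ → ℚ
Hstar n [] = 1ℚ
Hstar zero (s ∷ ss) = 0ℚ
Hstar (suc n) (s ∷ ss) = inv n s * Hstar (suc n) ss + Hstar n (s ∷ ss)

block : ℕ → List ℕ
block a = replicate a 2 ++ [ 1 ]

starIndex : List ℕ → List ℕ
starIndex = concatMap block

-- all Boolean vectors of length n (the 2^n choices of symbols ∘)
allVecs : (n : ℕ) → List (Vec Bool n)
allVecs zero = V.[] ∷ []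
allVecs (suc n) = concatMap (λ v → (true V.∷ v) ∷ (false V.∷ v) ∷ []) (allVecs n)

-- glue c ((o₂,b₂) ∷ ...) builds c ∘₂ b₂ ∘₃ b₃ ..., where true = "+", false = ","
glue : ℕ → List (Bool × ℕ) → List ℕ
glue c [] = [ c ]
glue c ((true , b) ∷ xs) = glue (c ℕ.+ b) xs
glue c ((false , b) ∷ xs) = c ∷ glue b xs

odd : ℕ → ℕ
odd a = 2 ℕ.* a ℕ.+ 1

depth : List ℕ → ℕ
depth = Data.List.length
  where import Data.List

sumℚ : List ℚ → ℚ
sumℚ [] = 0ℚ
sumℚ (x ∷ xs) = x + sumℚ xs

pIndex : (a₁ : ℕ) (as : List ℕ) → Vec Bool (Data.List.length as) → List ℕ
pIndex a₁ as o = glue (odd a₁) (Data.List.zip (V.toList o) (map odd as))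
  where import Data.List

rhsPartial : ℕ → (a₁ : ℕ) (as : List ℕ) → ℚ
rhsPartial n a₁ as =
  sumℚ (map (λ o → let p = pIndex a₁ as o in
                   ((+ (2 ℕ.^ depth p)) / 1) * H n p)
            (allVecs (Data.List.length as)))
  where import Data.List

-- Let w_N(k) = C(2N, N + k) / C(2N, N) and let Hᵂ_N(p) be H_N(p) with the largest
-- summation variable k₁ weighted by w_N(k₁). For every N the identity
--   H⋆_N({2}^a₁, 1, …, {2}^a_r, 1) = Σ_p 2^ℓ(p) Hᵂ_N(p)
-- holds exactly, because both sides satisfy the recurrences of H⋆_N in N and in the
-- number of leading 2's: w_{N+1}(k) ((N + 1)² - k²) = w_N(k) (N + 1)² absorbs a leading 2,
-- and summation by parts against Σ_k 2k w_N(k) = N absorbs a 1.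
-- Since 0 ≤ 1 - w_N(k) ≤ k²/N and every p = (x, p′) has x ≥ 3,
-- N (H_N(p) - Hᵂ_N(p)) ≤ H_N(1, p′) ≤ (1 + H_N(1))^r, and H_N(1) = O(log N),
-- so the two partial sums differ by O((log N)^r / N).

module Submission where

open import Algebra.Bundles using (CommutativeRing)
open import Data.Bool using (Bool; true; false)
open import Data.Integer as ℤ using (+≤+; +<+)
import Data.Integer.Properties as ℤₚ
open import Data.List using (List; []; _∷_; _++_; [_]; length; map; zip; concatMap; replicate)
import Data.List.Properties as Listₚ
open import Data.List.Relation.Unary.All using (All; []; _∷_)
open import Data.Nat as ℕ using (ℕ; zero; suc; s≤s; z≤n)
import Data.Nat.Properties as ℕₚ
open import Data.Nat.Tactic.RingSolver using () renaming (ring to ℕ-ring)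
open import Data.Product using (∃; _,_; proj₁; proj₂) renaming (_×_ to _∧_)
open import Data.Rational using (ℚ; mkℚ; 0ℚ; 1ℚ; _+_; _*_; _-_; -_; _/_; _≤_; _<_; ∣_∣; _≟_; *≤*; *<*; toℚᵘ; nonNegative)
open import Data.Rational.Properties
import Data.Rational.Unnormalised as ℚᵘ
import Data.Rational.Unnormalised.Properties as ℚᵘₚ
open import Data.Vec using (Vec)
import Data.Vec as Vec
open import Level using (0ℓ)
open import Relation.Binary.PropositionalEquality hiding ([_])
open import Relation.Nullary using (yes; no)
open import Relation.Nullary.Decidable using (dec⇒maybe)
open import Tactic.RingSolver using (solve-∀)
open import Tactic.RingSolver.Core.AlmostCommutativeRing using (AlmostCommutativeRing; fromCommutativeRing)

open import Defs

open CommutativeRing +-*-commutativeRing using (semiring)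
open import Algebra.Properties.Semiring.Mult semiring using (_×_; ×-homo-+; ×1-homo-*)
open import Algebra.Properties.Semiring.Exp semiring using (_^_)

ℚ-ring : AlmostCommutativeRing 0ℓ 0ℓ
ℚ-ring = fromCommutativeRing +-*-commutativeRing (λ x → dec⇒maybe (0ℚ ≟ x))

ι : ℕ → ℚ
ι n = n × 1ℚ

ι-+ : ∀ m n → ι (m ℕ.+ n) ≡ ι m + ι n
ι-+ m n = ×-homo-+ 1ℚ m n

ι-* : ∀ m n → ι (m ℕ.* n) ≡ ι m * ι n
ι-* = ×1-homo-*

ι-^ : ∀ m r → ι (m ℕ.^ r) ≡ ι m ^ r
ι-^ m zero = +-identityʳ 1ℚ
ι-^ m (suc r) = trans (ι-* m (m ℕ.^ r)) (cong (ι m *_) (ι-^ m r))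

ι-∸ : ∀ {m n} → m ℕ.≤ n → ι n ≡ ι m + ι (n ℕ.∸ m)
ι-∸ {m} {n} m≤n = trans (cong ι (sym (ℕₚ.m+[n∸m]≡n m≤n))) (ι-+ m (n ℕ.∸ m))

toℚᵘ-ι : ∀ n → toℚᵘ (ι n) ℚᵘ.≃ ℚᵘ.mkℚᵘ (ℤ.+ n) 0
toℚᵘ-ι zero = ℚᵘₚ.≃-refl
toℚᵘ-ι (suc n) = ℚᵘₚ.≃-trans (toℚᵘ-homo-+ 1ℚ (ι n))
  (ℚᵘₚ.≃-trans (ℚᵘₚ.+-congʳ (toℚᵘ 1ℚ) (toℚᵘ-ι n)) (ℚᵘ.*≡* (trans (ℤₚ.*-identityʳ _)
    (trans (cong (ℤ._+_ (ℤ.+ 1)) (ℤₚ.*-identityʳ (ℤ.+ n))) (sym (ℤₚ.*-identityʳ _))))))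

[a/n]*n≡a : ∀ a n .{{_ : ℕ.NonZero n}} → (ℤ.+ a / n) * ι n ≡ ι a
[a/n]*n≡a a (suc d) = toℚᵘ-injective (ℚᵘₚ.≃-trans (toℚᵘ-homo-* (ℤ.+ a / suc d) (ι (suc d)))
  (ℚᵘₚ.≃-trans (ℚᵘₚ.*-cong (toℚᵘ-fromℚᵘ (ℚᵘ.mkℚᵘ (ℤ.+ a) d)) (toℚᵘ-ι (suc d)))
    (ℚᵘₚ.≃-trans (ℚᵘ.*≡* (trans (ℤₚ.*-identityʳ _) (cong (λ z → ℤ._*_ (ℤ.+ a) (ℤ.+ suc z)) (sym (ℕₚ.*-identityʳ d)))))
      (ℚᵘₚ.≃-sym (toℚᵘ-ι a)))))

n/1≡ι : ∀ n → ℤ.+ n / 1 ≡ ι n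
n/1≡ι n = toℚᵘ-injective (ℚᵘₚ.≃-trans (toℚᵘ-fromℚᵘ (ℚᵘ.mkℚᵘ (ℤ.+ n) 0)) (ℚᵘₚ.≃-sym (toℚᵘ-ι n)))

0≤q-p⇒p≤q : ∀ {p q} → 0ℚ ≤ q - p → p ≤ q
0≤q-p⇒p≤q {p} {q} 0≤q-p = subst₂ _≤_ (+-identityˡ p) (algebra p q) (+-monoˡ-≤ p 0≤q-p)
  where
  algebra : ∀ p q → (q - p) + p ≡ q
  algebra = solve-∀ ℚ-ring

p≤q⇒0≤q-p : ∀ {p q} → p ≤ q → 0ℚ ≤ q - p
p≤q⇒0≤q-p {p} {q} p≤q = subst (_≤ q - p) (+-inverseʳ p) (+-monoˡ-≤ (- p) p≤q)

≤-by : ∀ {p q} r → q - p ≡ r → 0ℚ ≤ r → p ≤ q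
≤-by r q-p≡r 0≤r = 0≤q-p⇒p≤q (subst (0ℚ ≤_) (sym q-p≡r) 0≤r)

+-nonNeg : ∀ {p q} → 0ℚ ≤ p → 0ℚ ≤ q → 0ℚ ≤ p + q
+-nonNeg = +-mono-≤

*-nonNeg : ∀ {p q} → 0ℚ ≤ p → 0ℚ ≤ q → 0ℚ ≤ p * q
*-nonNeg {p} {q} 0≤p 0≤q = nonNegative⁻¹ (p * q) {{nonNeg*nonNeg⇒nonNeg p {{nonNegative 0≤p}} q {{nonNegative 0≤q}}}}

*-mono-≤-nonNeg : ∀ {a b c d} → 0ℚ ≤ a → 0ℚ ≤ c → a ≤ b → c ≤ d → a * c ≤ b * d
*-mono-≤-nonNeg {b = b} {c} 0≤a 0≤c a≤b c≤d =
  ≤-trans (*-monoʳ-≤-nonNeg c {{nonNegative 0≤c}} a≤b) (*-monoˡ-≤-nonNeg b {{nonNegative (≤-trans 0≤a a≤b)}} c≤d)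

0≤1 : 0ℚ ≤ 1ℚ
0≤1 = *≤* (+≤+ z≤n)

0≤ι : ∀ n → 0ℚ ≤ ι n
0≤ι zero = ≤-refl
0≤ι (suc n) = +-nonNeg 0≤1 (0≤ι n)

ι-mono-≤ : ∀ {m n} → m ℕ.≤ n → ι m ≤ ι n
ι-mono-≤ {m} {n} m≤n = ≤-by (ι (n ℕ.∸ m)) (trans (cong (_- ι m) (ι-∸ m≤n)) (algebra (ι m) (ι (n ℕ.∸ m)))) (0≤ι (n ℕ.∸ m))
  where
  algebra : ∀ a b → (a + b) - a ≡ b
  algebra = solve-∀ ℚ-ring

ι-mono-< : ∀ {m n} → m ℕ.< n → ι m < ι n
ι-mono-< {m} {suc n} (s≤s m≤n) =
  ≤-<-trans (ι-mono-≤ m≤n) (subst (_< 1ℚ + ι n) (+-identityˡ (ι n)) (+-monoˡ-< (ι n) {0ℚ} {1ℚ} (*<* (+<+ (s≤s z≤n)))))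

^-mono-≤ : ∀ {a b} k → 0ℚ ≤ a → a ≤ b → a ^ k ≤ b ^ k
^-mono-≤ zero 0≤a a≤b = ≤-refl
^-mono-≤ (suc k) 0≤a a≤b = *-mono-≤-nonNeg 0≤a (0≤^ k 0≤a) a≤b (^-mono-≤ k 0≤a a≤b)
  where
  0≤^ : ∀ {a} k → 0ℚ ≤ a → 0ℚ ≤ a ^ k
  0≤^ zero _ = 0≤1
  0≤^ (suc k) 0≤a = *-nonNeg 0≤a (0≤^ k 0≤a)

^-monoʳ-≤ : ∀ {a} → 1ℚ ≤ a → ∀ {m n} → m ℕ.≤ n → a ^ m ≤ a ^ n
^-monoʳ-≤ {a} 1≤a {n = n} z≤n = 1≤^ n
  where
  1≤^ : ∀ n → 1ℚ ≤ a ^ n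
  1≤^ zero = ≤-refl
  1≤^ (suc n) = *-mono-≤-nonNeg 0≤1 0≤1 1≤a (1≤^ n)
^-monoʳ-≤ {a} 1≤a (s≤s m≤n) = *-monoˡ-≤-nonNeg a {{nonNegative (≤-trans 0≤1 1≤a)}} (^-monoʳ-≤ 1≤a m≤n)

positive-as-fraction : ∀ ε → 0ℚ < ε → ∃ λ d → ∃ λ e → ε * ι (suc d) ≡ ι (suc e)
positive-as-fraction (mkℚ (ℤ.+ zero) d _) (*<* (+<+ ()))
positive-as-fraction (mkℚ ℤ.-[1+ e ] d _) (*<* ())
positive-as-fraction ε@(mkℚ (ℤ.+ suc e) d _) _ = d , e , trans (cong (_* ι (suc d)) (sym (↥p/↧p≡p ε))) ([a/n]*n≡a (suc e) (suc d))

<-by-denominator : ∀ {x ε} n M d e → ε * ι (suc d) ≡ ι (suc e) → 0ℚ ≤ x → ι n * x ≤ ι M → M ℕ.* suc d ℕ.< n → x < ε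
<-by-denominator {x} {ε} n M d e ε[1+d]≡1+e 0≤x nx≤M M[1+d]<n =
  *-cancelʳ-<-nonNeg (ι (suc d)) {{nonNegative (0≤ι (suc d))}} (*-cancelˡ-<-nonNeg (ι n) {{nonNegative (0≤ι n)}} (begin-strict
    ι n * (x * ι (suc d))   ≡⟨ sym (*-assoc (ι n) x (ι (suc d))) ⟩
    ι n * x * ι (suc d)     ≤⟨ *-monoʳ-≤-nonNeg (ι (suc d)) {{nonNegative (0≤ι (suc d))}} nx≤M ⟩
    ι M * ι (suc d)         ≡⟨ sym (ι-* M (suc d)) ⟩
    ι (M ℕ.* suc d)         <⟨ ι-mono-< M[1+d]<n ⟩
    ι n                     ≡⟨ sym (*-identityʳ (ι n)) ⟩
    ι n * 1ℚ                ≤⟨ *-monoˡ-≤-nonNeg (ι n) {{nonNegative (0≤ι n)}} (ι-mono-≤ {1} {suc e} (s≤s z≤n)) ⟩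
    ι n * ι (suc e)         ≡⟨ cong (ι n *_) (sym ε[1+d]≡1+e) ⟩
    ι n * (ε * ι (suc d))   ∎))
  where open ≤-Reasoning

*-inverse-unique : ∀ {a b x} → a * x ≡ 1ℚ → b * x ≡ 1ℚ → a ≡ b
*-inverse-unique {a} {b} {x} ax≡1 bx≡1 = begin
  a             ≡⟨ sym (*-identityʳ a) ⟩
  a * 1ℚ        ≡⟨ cong (a *_) (sym bx≡1) ⟩
  a * (b * x)   ≡⟨ algebra a b x ⟩
  b * (a * x)   ≡⟨ cong (b *_) ax≡1 ⟩
  b * 1ℚ        ≡⟨ *-identityʳ b ⟩
  b             ∎
  where
  open ≡-Reasoning
  algebra : ∀ a b x → a * (b * x) ≡ b * (a * x)
  algebra = solve-∀ ℚ-ring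

inverse-antitone : ∀ {a b x y} → 0ℚ ≤ a → 0ℚ ≤ b → a * x ≡ 1ℚ → b * y ≡ 1ℚ → y ≤ x → a ≤ b
inverse-antitone {a} {b} {x} {y} 0≤a 0≤b ax≡1 by≡1 y≤x = begin
  a             ≡⟨ sym (*-identityʳ a) ⟩
  a * 1ℚ        ≡⟨ cong (a *_) (sym by≡1) ⟩
  a * (b * y)   ≡⟨ algebra a b y ⟩
  b * (a * y)   ≤⟨ *-monoˡ-≤-nonNeg b {{nonNegative 0≤b}} (*-monoˡ-≤-nonNeg a {{nonNegative 0≤a}} y≤x) ⟩
  b * (a * x)   ≡⟨ cong (b *_) ax≡1 ⟩
  b * 1ℚ        ≡⟨ *-identityʳ b ⟩
  b             ∎
  where
  open ≤-Reasoning
  algebra : ∀ a b y → a * (b * y) ≡ b * (a * y)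
  algebra = solve-∀ ℚ-ring

inv-*-ι^ : ∀ i s → inv i s * ι (suc i ℕ.^ s) ≡ 1ℚ
inv-*-ι^ i s = trans ([a/n]*n≡a 1 (suc i ℕ.^ s) {{ℕₚ.m^n≢0 (suc i) s}}) (+-identityʳ 1ℚ)

inv-+ : ∀ i s t → inv i (s ℕ.+ t) ≡ inv i s * inv i t
inv-+ i s t = *-inverse-unique (inv-*-ι^ i (s ℕ.+ t)) (begin
  inv i s * inv i t * ι (suc i ℕ.^ (s ℕ.+ t))
    ≡⟨ cong (λ z → inv i s * inv i t * ι z) (ℕₚ.^-distribˡ-+-* (suc i) s t) ⟩
  inv i s * inv i t * ι (suc i ℕ.^ s ℕ.* suc i ℕ.^ t)
    ≡⟨ cong (inv i s * inv i t *_) (ι-* (suc i ℕ.^ s) (suc i ℕ.^ t)) ⟩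
  inv i s * inv i t * (ι (suc i ℕ.^ s) * ι (suc i ℕ.^ t))
    ≡⟨ algebra (inv i s) (inv i t) (ι (suc i ℕ.^ s)) (ι (suc i ℕ.^ t)) ⟩
  (inv i s * ι (suc i ℕ.^ s)) * (inv i t * ι (suc i ℕ.^ t))
    ≡⟨ cong₂ _*_ (inv-*-ι^ i s) (inv-*-ι^ i t) ⟩
  1ℚ ∎)
  where
  open ≡-Reasoning
  algebra : ∀ a b x y → a * b * (x * y) ≡ (a * x) * (b * y)
  algebra = solve-∀ ℚ-ring

inv-1 : ∀ i → inv i 1 * ι (suc i) ≡ 1ℚ
inv-1 i = trans (cong (λ z → inv i 1 * ι z) (sym (ℕₚ.*-identityʳ (suc i)))) (inv-*-ι^ i 1)

inv-2 : ∀ i → inv i 2 * (ι (suc i) * ι (suc i)) ≡ 1ℚ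
inv-2 i = trans (cong (inv i 2 *_) (sym ι[k²]≡k*k)) (inv-*-ι^ i 2)
  where
  ι[k²]≡k*k : ι (suc i ℕ.^ 2) ≡ ι (suc i) * ι (suc i)
  ι[k²]≡k*k = trans (cong (λ z → ι (suc i ℕ.* z)) (ℕₚ.*-identityʳ (suc i))) (ι-* (suc i) (suc i))

inv-2-*-ι : ∀ n → inv n 2 * ι (suc n) ≡ inv n 1
inv-2-*-ι n = begin
  inv n 2 * ι (suc n)               ≡⟨ cong (_* ι (suc n)) (inv-+ n 1 1) ⟩
  inv n 1 * inv n 1 * ι (suc n)     ≡⟨ *-assoc (inv n 1) (inv n 1) (ι (suc n)) ⟩
  inv n 1 * (inv n 1 * ι (suc n))   ≡⟨ cong (inv n 1 *_) (inv-1 n) ⟩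
  inv n 1 * 1ℚ                      ≡⟨ *-identityʳ (inv n 1) ⟩
  inv n 1                           ∎
  where open ≡-Reasoning

inv-shift : ∀ i s → (ι (suc i) * ι (suc i)) * inv i (s ℕ.+ 2) ≡ inv i s
inv-shift i s = begin
  k² * inv i (s ℕ.+ 2)     ≡⟨ cong (k² *_) (inv-+ i s 2) ⟩
  k² * (inv i s * inv i 2) ≡⟨ algebra k² (inv i s) (inv i 2) ⟩
  inv i s * (inv i 2 * k²) ≡⟨ cong (inv i s *_) (inv-2 i) ⟩
  inv i s * 1ℚ             ≡⟨ *-identityʳ (inv i s) ⟩
  inv i s                  ∎
  where
  open ≡-Reasoning
  k² = ι (suc i) * ι (suc i)
  algebra : ∀ k² a b → k² * (a * b) ≡ a * (b * k²)
  algebra = solve-∀ ℚ-ring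

0≤inv : ∀ i s → 0ℚ ≤ inv i s
0≤inv i s = nonNegative⁻¹ (inv i s) {{normalize-nonNeg 1 (suc i ℕ.^ s) {{ℕₚ.m^n≢0 (suc i) s}}}}

inv≤1 : ∀ i s → inv i s ≤ 1ℚ
inv≤1 i s = ≤-by (inv i s * ι (X ℕ.∸ 1)) (begin
  1ℚ - inv i s                              ≡⟨ cong (_- inv i s) (sym (inv-*-ι^ i s)) ⟩
  inv i s * ι X - inv i s                   ≡⟨ cong (λ z → inv i s * z - inv i s) (ι-∸ (ℕₚ.m^n>0 (suc i) s)) ⟩
  inv i s * (1ℚ + ι (X ℕ.∸ 1)) - inv i s    ≡⟨ algebra (inv i s) (ι (X ℕ.∸ 1)) ⟩
  inv i s * ι (X ℕ.∸ 1)                     ∎) (*-nonNeg (0≤inv i s) (0≤ι (X ℕ.∸ 1)))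
  where
  open ≡-Reasoning
  X = suc i ℕ.^ s
  algebra : ∀ a d → a * (1ℚ + d) - a ≡ a * d
  algebra = solve-∀ ℚ-ring

inv-antitone : ∀ i {s t} → s ℕ.≤ t → inv i t ≤ inv i s
inv-antitone i {s} {t} s≤t = subst (λ u → inv i u ≤ inv i s) (ℕₚ.m+[n∸m]≡n s≤t) (begin
  inv i (s ℕ.+ (t ℕ.∸ s))        ≡⟨ inv-+ i s (t ℕ.∸ s) ⟩
  inv i s * inv i (t ℕ.∸ s)      ≤⟨ *-monoˡ-≤-nonNeg (inv i s) {{nonNegative (0≤inv i s)}} (inv≤1 i (t ℕ.∸ s)) ⟩
  inv i s * 1ℚ                   ≡⟨ *-identityʳ (inv i s) ⟩
  inv i s                        ∎)
  where open ≤-Reasoning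

inv-antitoneˡ : ∀ {i j} s → i ℕ.≤ j → inv j s ≤ inv i s
inv-antitoneˡ {i} {j} s i≤j = inverse-antitone (0≤inv j s) (0≤inv i s) (inv-*-ι^ j s) (inv-*-ι^ i s)
  (ι-mono-≤ (ℕₚ.^-monoˡ-≤ s (s≤s i≤j)))

inv-1-*-ι≤1 : ∀ {N} i → N ℕ.≤ suc i → inv i 1 * ι N ≤ 1ℚ
inv-1-*-ι≤1 i N≤1+i = ≤-trans
  (*-monoˡ-≤-nonNeg (inv i 1) {{nonNegative (0≤inv i 1)}} (ι-mono-≤ N≤1+i)) (≤-reflexive (inv-1 i))

∑< : ℕ → (ℕ → ℚ) → ℚ
∑< zero f = 0ℚ
∑< (suc n) f = f n + ∑< n f

syntax ∑< n (λ i → e) = ∑[ i < n ] e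

∑-cong : ∀ n {f g : ℕ → ℚ} → (∀ i → f i ≡ g i) → ∑< n f ≡ ∑< n g
∑-cong zero f≡g = refl
∑-cong (suc n) f≡g = cong₂ _+_ (f≡g n) (∑-cong n f≡g)

∑-+ : ∀ n (f g : ℕ → ℚ) → ∑[ i < n ] (f i + g i) ≡ ∑< n f + ∑< n g
∑-+ zero f g = refl
∑-+ (suc n) f g = trans (cong (f n + g n +_) (∑-+ n f g)) (algebra (f n) (g n) (∑< n f) (∑< n g))
  where
  algebra : ∀ a b c d → (a + b) + (c + d) ≡ (a + c) + (b + d)
  algebra = solve-∀ ℚ-ring

∑-*ˡ : ∀ n c (f : ℕ → ℚ) → ∑[ i < n ] (c * f i) ≡ c * ∑< n f
∑-*ˡ zero c f = sym (*-zeroʳ c)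
∑-*ˡ (suc n) c f = trans (cong (c * f n +_) (∑-*ˡ n c f)) (sym (*-distribˡ-+ c (f n) (∑< n f)))

∑-- : ∀ n (f g : ℕ → ℚ) → ∑[ i < n ] (f i - g i) ≡ ∑< n f - ∑< n g
∑-- zero f g = refl
∑-- (suc n) f g = trans (cong (f n - g n +_) (∑-- n f g)) (algebra (f n) (g n) (∑< n f) (∑< n g))
  where
  algebra : ∀ a b c d → (a - b) + (c - d) ≡ (a + c) - (b + d)
  algebra = solve-∀ ℚ-ring

∑-nonNeg : ∀ n (f : ℕ → ℚ) → (∀ i → i ℕ.< n → 0ℚ ≤ f i) → 0ℚ ≤ ∑< n f
∑-nonNeg zero f 0≤f = ≤-refl
∑-nonNeg (suc n) f 0≤f = +-nonNeg (0≤f n ℕₚ.≤-refl) (∑-nonNeg n f (λ i i<n → 0≤f i (ℕₚ.m≤n⇒m≤1+n i<n)))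

∑-mono-≤ : ∀ n (f g : ℕ → ℚ) → (∀ i → i ℕ.< n → f i ≤ g i) → ∑< n f ≤ ∑< n g
∑-mono-≤ zero f g f≤g = ≤-refl
∑-mono-≤ (suc n) f g f≤g = +-mono-≤ (f≤g n ℕₚ.≤-refl) (∑-mono-≤ n f g (λ i i<n → f≤g i (ℕₚ.m≤n⇒m≤1+n i<n)))

∑-telescope : ∀ n (t : ℕ → ℚ) → ∑[ i < n ] (t i - t (suc i)) ≡ t 0 - t n
∑-telescope zero t = sym (+-inverseʳ (t 0))
∑-telescope (suc n) t = trans (cong (t n - t (suc n) +_) (∑-telescope n t)) (algebra (t 0) (t n) (t (suc n)))
  where
  algebra : ∀ a b c → (b - c) + (a - b) ≡ a - c
  algebra = solve-∀ ℚ-ring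

∑-by-parts : ∀ n (t g : ℕ → ℚ) →
  ∑[ i < n ] ((t i - t (suc i)) * ∑< i g) ≡ ∑[ i < n ] (t (suc i) * g i) - t n * ∑< n g
∑-by-parts zero t g = sym (trans (cong (λ z → 0ℚ - z) (*-zeroʳ (t 0))) (+-inverseʳ 0ℚ))
∑-by-parts (suc n) t g = trans (cong ((t n - t (suc n)) * ∑< n g +_) (∑-by-parts n t g))
  (algebra (t n) (t (suc n)) (g n) (∑< n g) (∑[ i < n ] (t (suc i) * g i)))
  where
  algebra : ∀ a b x G S → (a - b) * G + (S - a * G) ≡ (b * x + S) - b * (x + G)
  algebra = solve-∀ ℚ-ring

sumℚ-map-cong : ∀ {A : Set} {f g : A → ℚ} (L : List A) → (∀ v → f v ≡ g v) → sumℚ (map f L) ≡ sumℚ (map g L)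
sumℚ-map-cong [] f≡g = refl
sumℚ-map-cong (v ∷ L) f≡g = cong₂ _+_ (f≡g v) (sumℚ-map-cong L f≡g)

sumℚ-map-zero : ∀ {A : Set} (f : A → ℚ) (L : List A) → (∀ v → f v ≡ 0ℚ) → sumℚ (map f L) ≡ 0ℚ
sumℚ-map-zero f [] _ = refl
sumℚ-map-zero f (v ∷ L) f≡0 = trans (cong₂ _+_ (f≡0 v) (sumℚ-map-zero f L f≡0)) (+-identityʳ 0ℚ)

sumℚ-map-affine : ∀ {A : Set} X (f g h : A → ℚ) (L : List A) → (∀ v → f v ≡ X * g v + h v) →
  sumℚ (map f L) ≡ X * sumℚ (map g L) + sumℚ (map h L)
sumℚ-map-affine X f g h [] _ = sym (trans (cong (_+ 0ℚ) (*-zeroʳ X)) (+-identityʳ 0ℚ))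
sumℚ-map-affine X f g h (v ∷ L) f≡ = trans (cong₂ _+_ (f≡ v) (sumℚ-map-affine X f g h L f≡))
  (algebra X (g v) (h v) (sumℚ (map g L)) (sumℚ (map h L)))
  where
  algebra : ∀ X a b A B → X * a + b + (X * A + B) ≡ X * (a + A) + (b + B)
  algebra = solve-∀ ℚ-ring

sumℚ-map-pairs : ∀ {A B : Set} (φ : B → ℚ) (h₁ h₂ : A → B) (L : List A) →
  sumℚ (map φ (concatMap (λ v → h₁ v ∷ h₂ v ∷ []) L)) ≡ sumℚ (map (λ v → φ (h₁ v) + φ (h₂ v)) L)
sumℚ-map-pairs φ h₁ h₂ [] = refl
sumℚ-map-pairs φ h₁ h₂ (v ∷ L) = trans (cong (λ z → φ (h₁ v) + (φ (h₂ v) + z)) (sumℚ-map-pairs φ h₁ h₂ L))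
  (sym (+-assoc (φ (h₁ v)) (φ (h₂ v)) _))

sumℚ-map-- : ∀ {A : Set} (f g : A → ℚ) (L : List A) → sumℚ (map f L) - sumℚ (map g L) ≡ sumℚ (map (λ v → f v - g v) L)
sumℚ-map-- f g [] = refl
sumℚ-map-- f g (v ∷ L) = trans (algebra (f v) (sumℚ (map f L)) (g v) (sumℚ (map g L))) (cong (f v - g v +_) (sumℚ-map-- f g L))
  where
  algebra : ∀ a A b B → (a + A) - (b + B) ≡ (a - b) + (A - B)
  algebra = solve-∀ ℚ-ring

sumℚ-map-*ˡ : ∀ {A : Set} c (f : A → ℚ) (L : List A) → c * sumℚ (map f L) ≡ sumℚ (map (λ v → c * f v) L)
sumℚ-map-*ˡ c f [] = *-zeroʳ c
sumℚ-map-*ˡ c f (v ∷ L) = trans (*-distribˡ-+ c (f v) (sumℚ (map f L))) (cong (c * f v +_) (sumℚ-map-*ˡ c f L))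

sumℚ-map-nonNeg : ∀ {A : Set} (f : A → ℚ) (L : List A) → (∀ v → 0ℚ ≤ f v) → 0ℚ ≤ sumℚ (map f L)
sumℚ-map-nonNeg f [] _ = ≤-refl
sumℚ-map-nonNeg f (v ∷ L) 0≤f = +-nonNeg (0≤f v) (sumℚ-map-nonNeg f L 0≤f)

sumℚ-map-≤ : ∀ {A : Set} (f : A → ℚ) B (L : List A) → (∀ v → f v ≤ B) → sumℚ (map f L) ≤ ι (length L) * B
sumℚ-map-≤ f B [] _ = ≤-reflexive (sym (*-zeroˡ B))
sumℚ-map-≤ f B (v ∷ L) f≤B = ≤-trans (+-mono-≤ (f≤B v) (sumℚ-map-≤ f B L f≤B))
  (≤-reflexive (algebra B (ι (length L))))
  where
  algebra : ∀ B l → B + l * B ≡ (1ℚ + l) * B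
  algebra = solve-∀ ℚ-ring

H-unfold : ∀ n s q → H n (s ∷ q) ≡ ∑[ i < n ] (inv i s * H i q)
H-unfold zero s q = refl
H-unfold (suc n) s q = cong (inv n s * H n q +_) (H-unfold n s q)

0≤H : ∀ n q → 0ℚ ≤ H n q
0≤H n [] = 0≤1
0≤H zero (s ∷ q) = ≤-refl
0≤H (suc n) (s ∷ q) = +-nonNeg (*-nonNeg (0≤inv n s) (0≤H n q)) (0≤H n (s ∷ q))

harmonic : ℕ → ℚ
harmonic n = H n [ 1 ]

0≤harmonic : ∀ n → 0ℚ ≤ harmonic n
0≤harmonic n = 0≤H n [ 1 ]

H≤harmonic^depth : ∀ n q → All (1 ℕ.≤_) q → H n q ≤ harmonic n ^ length q
H≤harmonic^depth n [] [] = ≤-refl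
H≤harmonic^depth zero (s ∷ q) _ = ≤-reflexive (sym (*-zeroˡ (harmonic 0 ^ length q)))
H≤harmonic^depth (suc n) (suc t ∷ q) (_ ∷ q⁺) = begin
  inv n (suc t) * H n q + H n (suc t ∷ q)
    ≤⟨ +-mono-≤ (*-mono-≤-nonNeg (0≤inv n (suc t)) (0≤H n q) (inv-antitone n {1} {suc t} (s≤s z≤n)) (H≤harmonic^depth n q q⁺))
                (H≤harmonic^depth n (suc t ∷ q) (s≤s z≤n ∷ q⁺)) ⟩
  y * T ^ ℓ + T * T ^ ℓ
    ≡⟨ sym (*-distribʳ-+ (T ^ ℓ) y T) ⟩
  (y + T) * T ^ ℓ
    ≤⟨ *-monoˡ-≤-nonNeg (y + T) {{nonNegative (+-nonNeg (0≤inv n 1) (0≤harmonic n))}}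
         (^-mono-≤ ℓ (0≤harmonic n) (≤-by y (algebra y T) (0≤inv n 1))) ⟩
  (y + T) * (y + T) ^ ℓ
    ≡⟨ cong (λ z → (z + T) * (z + T) ^ ℓ) (sym (*-identityʳ y)) ⟩
  harmonic (suc n) ^ suc ℓ ∎
  where
  open ≤-Reasoning
  y = inv n 1
  T = harmonic n
  ℓ = length q
  algebra : ∀ y T → (y + T) - T ≡ y
  algebra = solve-∀ ℚ-ring

harmonic-≤-suc : ∀ n → harmonic n ≤ harmonic (suc n)
harmonic-≤-suc n = ≤-by (inv n 1 * 1ℚ) (algebra (inv n 1 * 1ℚ) (harmonic n)) (*-nonNeg (0≤inv n 1) 0≤1)
  where
  algebra : ∀ a T → (a + T) - T ≡ a
  algebra = solve-∀ ℚ-ring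

harmonic-mono-≤ : ∀ {m n} → m ℕ.≤ n → harmonic m ≤ harmonic n
harmonic-mono-≤ m≤n = go (ℕₚ.≤⇒≤′ m≤n)
  where
  go : ∀ {m n} → m ℕ.≤′ n → harmonic m ≤ harmonic n
  go ℕ.≤′-refl = ≤-refl
  go {n = suc n} (ℕ.≤′-step m≤′n) = ≤-trans (go m≤′n) (harmonic-≤-suc n)

harmonic-+ : ∀ j M → harmonic (j ℕ.+ M) ≤ harmonic M + ι j * inv M 1
harmonic-+ zero M = ≤-reflexive (sym (trans (cong (harmonic M +_) (*-zeroˡ (inv M 1))) (+-identityʳ (harmonic M))))
harmonic-+ (suc j) M = begin
  inv (j ℕ.+ M) 1 * 1ℚ + harmonic (j ℕ.+ M)   ≤⟨ +-mono-≤ (≤-trans (≤-reflexive (*-identityʳ _)) (inv-antitoneˡ 1 (ℕₚ.m≤n+m M j))) (harmonic-+ j M) ⟩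
  inv M 1 + (harmonic M + ι j * inv M 1)       ≡⟨ algebra (inv M 1) (harmonic M) (ι j) ⟩
  harmonic M + ι (suc j) * inv M 1             ∎
  where
  open ≤-Reasoning
  algebra : ∀ ρ T j → ρ + (T + j * ρ) ≡ T + (1ℚ + j) * ρ
  algebra = solve-∀ ℚ-ring

harmonic-double : ∀ M → harmonic (M ℕ.+ M) ≤ harmonic M + 1ℚ
harmonic-double M = ≤-trans (harmonic-+ M M)
  (+-monoʳ-≤ (harmonic M) (≤-trans (≤-reflexive (*-comm (ι M) (inv M 1))) (inv-1-*-ι≤1 M (ℕₚ.n≤1+n M))))

harmonic-2^ : ∀ t → harmonic (2 ℕ.^ t) ≤ 1ℚ + ι t
harmonic-2^ zero = ≤-refl
harmonic-2^ (suc t) = begin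
  harmonic (2 ℕ.^ t ℕ.+ (2 ℕ.^ t ℕ.+ 0))   ≡⟨ cong (λ m → harmonic (2 ℕ.^ t ℕ.+ m)) (ℕₚ.+-identityʳ (2 ℕ.^ t)) ⟩
  harmonic (2 ℕ.^ t ℕ.+ 2 ℕ.^ t)          ≤⟨ harmonic-double (2 ℕ.^ t) ⟩
  harmonic (2 ℕ.^ t) + 1ℚ                 ≤⟨ +-monoˡ-≤ 1ℚ (harmonic-2^ t) ⟩
  (1ℚ + ι t) + 1ℚ                         ≡⟨ algebra (ι t) ⟩
  1ℚ + ι (suc t)                          ∎
  where
  open ≤-Reasoning
  algebra : ∀ t → (1ℚ + t) + 1ℚ ≡ 1ℚ + (1ℚ + t)
  algebra = solve-∀ ℚ-ring

-- The weights

-- w N m = ∏_{j<m} (N - j)/(N + j + 1) = C(2N, N + m) / C(2N, N)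

w : ℕ → ℕ → ℚ
w N zero = 1ℚ
w N (suc m) = w N m * ((ι N - ι m) * inv (N ℕ.+ m) 1)

inv-1-+ : ∀ N m → inv (N ℕ.+ m) 1 * (1ℚ + (ι N + ι m)) ≡ 1ℚ
inv-1-+ N m = trans (cong (λ z → inv (N ℕ.+ m) 1 * (1ℚ + z)) (sym (ι-+ N m))) (inv-1 (N ℕ.+ m))

w-vanishes : ∀ N → w N (suc N) ≡ 0ℚ
w-vanishes N = begin
  w N N * ((ι N - ι N) * inv (N ℕ.+ N) 1) ≡⟨ cong (λ z → w N N * (z * inv (N ℕ.+ N) 1)) (+-inverseʳ (ι N)) ⟩
  w N N * (0ℚ * inv (N ℕ.+ N) 1)          ≡⟨ cong (w N N *_) (*-zeroˡ (inv (N ℕ.+ N) 1)) ⟩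
  w N N * 0ℚ                              ≡⟨ *-zeroʳ (w N N) ⟩
  0ℚ                                      ∎
  where open ≡-Reasoning

w-shift : ∀ N m → (ι N + ι (suc m)) * w N (suc m) ≡ (ι N - ι m) * w N m
w-shift N m = begin
  (n + (1ℚ + k)) * (W * ((n - k) * ρ)) ≡⟨ algebra n k W ρ ⟩
  (n - k) * W * (ρ * (1ℚ + (n + k)))   ≡⟨ cong ((n - k) * W *_) (inv-1-+ N m) ⟩
  (n - k) * W * 1ℚ                     ≡⟨ *-identityʳ _ ⟩
  (n - k) * W                          ∎
  where
  open ≡-Reasoning
  n = ι N
  k = ι m
  W = w N m
  ρ = inv (N ℕ.+ m) 1
  algebra : ∀ n k W ρ → (n + (1ℚ + k)) * (W * ((n - k) * ρ)) ≡ (n - k) * W * (ρ * (1ℚ + (n + k)))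
  algebra = solve-∀ ℚ-ring

w⁺ : ℕ → ℕ → ℚ
w⁺ N m = (ι N + ι m) * w N m

w⁺-vanishes : ∀ N → w⁺ N (suc N) ≡ 0ℚ
w⁺-vanishes N = trans (cong ((ι N + ι (suc N)) *_) (w-vanishes N)) (*-zeroʳ (ι N + ι (suc N)))

w-telescope : ∀ N i → ι 2 * (ι (suc i) * w N (suc i)) ≡ w⁺ N (suc i) - w⁺ N (suc (suc i))
w-telescope N i = trans (algebra (ι N) (ι (suc i)) (w N (suc i))) (cong (_-_ (w⁺ N (suc i))) (sym (w-shift N (suc i))))
  where
  algebra : ∀ n k W → ι 2 * (k * W) ≡ (n + k) * W - (n - k) * W
  algebra = solve-∀ ℚ-ring

∑-weighted-moment : ∀ N → ∑[ i < N ] (ι 2 * (ι (suc i) * w N (suc i))) ≡ ι N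
∑-weighted-moment N = begin
  ∑[ i < N ] (ι 2 * (ι (suc i) * w N (suc i)))           ≡⟨ ∑-cong N (w-telescope N) ⟩
  ∑[ i < N ] (w⁺ N (suc i) - w⁺ N (suc (suc i)))               ≡⟨ ∑-telescope N (λ i → w⁺ N (suc i)) ⟩
  w⁺ N 1 - w⁺ N (suc N)                                        ≡⟨ cong₂ _-_ (w-shift N 0) (w⁺-vanishes N) ⟩
  (ι N - 0ℚ) * 1ℚ - 0ℚ                                          ≡⟨ algebra (ι N) ⟩
  ι N                                                           ∎
  where
  open ≡-Reasoning
  algebra : ∀ n → (n - 0ℚ) * 1ℚ - 0ℚ ≡ n
  algebra = solve-∀ ℚ-ring

∑-weighted-by-parts : ∀ N (g : ℕ → ℚ) →
  ι 2 * ∑[ i < N ] (ι (suc i) * w N (suc i) * ∑< i g) + ∑[ i < N ] (ι (suc i) * w N (suc i) * g i)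
    ≡ ι N * ∑[ i < N ] (w N (suc i) * g i)
∑-weighted-by-parts N g = begin
  ι 2 * ∑[ i < N ] (a i * G i) + ∑[ i < N ] (a i * g i)
    ≡⟨ cong (_+ ∑[ i < N ] (a i * g i)) (sym (∑-*ˡ N (ι 2) (λ i → a i * G i))) ⟩
  ∑[ i < N ] (ι 2 * (a i * G i)) + ∑[ i < N ] (a i * g i)
    ≡⟨ cong (_+ ∑[ i < N ] (a i * g i)) (∑-cong N λ i →
         trans (sym (*-assoc (ι 2) (a i) (G i))) (cong (_* G i) (w-telescope N i))) ⟩
  ∑[ i < N ] ((t i - t (suc i)) * G i) + ∑[ i < N ] (a i * g i)
    ≡⟨ cong (_+ ∑[ i < N ] (a i * g i)) (∑-by-parts N t g) ⟩
  (∑[ i < N ] (t (suc i) * g i) - t N * G N) + ∑[ i < N ] (a i * g i)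
    ≡⟨ cong (λ z → (∑[ i < N ] (t (suc i) * g i) - z * G N) + ∑[ i < N ] (a i * g i)) (w⁺-vanishes N) ⟩
  (∑[ i < N ] (t (suc i) * g i) - 0ℚ * G N) + ∑[ i < N ] (a i * g i)
    ≡⟨ algebra₁ (∑[ i < N ] (t (suc i) * g i)) (G N) (∑[ i < N ] (a i * g i)) ⟩
  ∑[ i < N ] (t (suc i) * g i) + ∑[ i < N ] (a i * g i)
    ≡⟨ sym (∑-+ N (λ i → t (suc i) * g i) (λ i → a i * g i)) ⟩
  ∑[ i < N ] (t (suc i) * g i + a i * g i)
    ≡⟨ ∑-cong N (λ i → trans (cong (λ z → z * g i + a i * g i) (w-shift N (suc i)))
         (algebra₂ (ι N) (ι (suc i)) (w N (suc i)) (g i))) ⟩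
  ∑[ i < N ] (ι N * (w N (suc i) * g i))
    ≡⟨ ∑-*ˡ N (ι N) (λ i → w N (suc i) * g i) ⟩
  ι N * ∑[ i < N ] (w N (suc i) * g i) ∎
  where
  open ≡-Reasoning
  a t G : ℕ → ℚ
  a i = ι (suc i) * w N (suc i)
  t i = w⁺ N (suc i)
  G i = ∑< i g
  algebra₁ : ∀ S G A → (S - 0ℚ * G) + A ≡ S + A
  algebra₁ = solve-∀ ℚ-ring
  algebra₂ : ∀ n k W x → (n - k) * W * x + k * W * x ≡ n * (W * x)
  algebra₂ = solve-∀ ℚ-ring

w-recurrence : ∀ N m →
  w (suc N) m * (ι (suc N) * ι (suc N) - ι m * ι m) ≡ w N m * (ι (suc N) * ι (suc N))
w-recurrence N zero = algebra (ι (suc N))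
  where
  algebra : ∀ n → 1ℚ * (n * n - 0ℚ * 0ℚ) ≡ 1ℚ * (n * n)
  algebra = solve-∀ ℚ-ring
w-recurrence N (suc m) = begin
  W' * ((n' - k) * ρ') * (n' * n' - (1ℚ + k) * (1ℚ + k))
    ≡⟨ algebra₁ W' n k ρ' ⟩
  W' * (n' - k) * (n - k) * (ρ' * (1ℚ + (n' + k)))
    ≡⟨ cong (W' * (n' - k) * (n - k) *_) (trans (inv-1-+ (suc N) m) (sym (inv-1-+ N m))) ⟩
  W' * (n' - k) * (n - k) * (ρ * (1ℚ + (n + k)))
    ≡⟨ algebra₂ W' n k ρ ⟩
  W' * (n' * n' - k * k) * ((n - k) * ρ)
    ≡⟨ cong (_* ((n - k) * ρ)) (w-recurrence N m) ⟩
  W * (n' * n') * ((n - k) * ρ)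
    ≡⟨ algebra₃ W n' (n - k) ρ ⟩
  W * ((n - k) * ρ) * (n' * n') ∎
  where
  open ≡-Reasoning
  W' = w (suc N) m
  W = w N m
  n = ι N
  n' = ι (suc N)
  k = ι m
  ρ' = inv (suc N ℕ.+ m) 1
  ρ = inv (N ℕ.+ m) 1
  algebra₁ : ∀ W' n k ρ' →
    W' * (((1ℚ + n) - k) * ρ') * ((1ℚ + n) * (1ℚ + n) - (1ℚ + k) * (1ℚ + k))
      ≡ W' * ((1ℚ + n) - k) * (n - k) * (ρ' * (1ℚ + ((1ℚ + n) + k)))
  algebra₁ = solve-∀ ℚ-ring
  algebra₂ : ∀ W' n k ρ →
    W' * ((1ℚ + n) - k) * (n - k) * (ρ * (1ℚ + (n + k)))
      ≡ W' * ((1ℚ + n) * (1ℚ + n) - k * k) * ((n - k) * ρ)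
  algebra₂ = solve-∀ ℚ-ring
  algebra₃ : ∀ W n' d ρ → W * (n' * n') * (d * ρ) ≡ W * (d * ρ) * (n' * n')
  algebra₃ = solve-∀ ℚ-ring

w-suc : ∀ n m → w (suc n) m ≡ w n m + inv n 2 * (w (suc n) m * (ι m * ι m))
w-suc n m = sym (begin
  W + X * (W' * k²)               ≡⟨ cong (_+ X * (W' * k²)) (sym (*-identityʳ W)) ⟩
  W * 1ℚ + X * (W' * k²)          ≡⟨ cong (λ z → W * z + X * (W' * k²)) (sym (inv-2 n)) ⟩
  W * (X * P) + X * (W' * k²)     ≡⟨ algebra₁ W X P W' k² ⟩
  X * (W * P + W' * k²)           ≡⟨ cong (λ z → X * (z + W' * k²)) (sym (w-recurrence n m)) ⟩
  X * (W' * (P - k²) + W' * k²)   ≡⟨ algebra₂ X W' P k² ⟩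
  W' * (X * P)                    ≡⟨ cong (W' *_) (inv-2 n) ⟩
  W' * 1ℚ                         ≡⟨ *-identityʳ W' ⟩
  W'                              ∎)
  where
  open ≡-Reasoning
  W = w n m
  W' = w (suc n) m
  k² = ι m * ι m
  X = inv n 2
  P = ι (suc n) * ι (suc n)
  algebra₁ : ∀ W X P W' k² → W * (X * P) + X * (W' * k²) ≡ X * (W * P + W' * k²)
  algebra₁ = solve-∀ ℚ-ring
  algebra₂ : ∀ X W' P k² → X * (W' * (P - k²) + W' * k²) ≡ W' * (X * P)
  algebra₂ = solve-∀ ℚ-ring

1-w-suc : ∀ N m → 1ℚ - w N (suc m) ≡ (1ℚ - w N m) + w N m * ((1ℚ + (ι m + ι m)) * inv (N ℕ.+ m) 1)
1-w-suc N m = begin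
  1ℚ - W * ((n - k) * ρ)                                                ≡⟨ algebra₁ W n k ρ ⟩
  (1ℚ - W) + W * ((1ℚ + (k + k)) * ρ) + W * (1ℚ - ρ * (1ℚ + (n + k)))    ≡⟨ cong (λ z → (1ℚ - W) + W * ((1ℚ + (k + k)) * ρ) + W * (1ℚ - z)) (inv-1-+ N m) ⟩
  (1ℚ - W) + W * ((1ℚ + (k + k)) * ρ) + W * (1ℚ - 1ℚ)                   ≡⟨ algebra₂ W k ρ ⟩
  (1ℚ - W) + W * ((1ℚ + (k + k)) * ρ)                                   ∎
  where
  open ≡-Reasoning
  W = w N m
  n = ι N
  k = ι m
  ρ = inv (N ℕ.+ m) 1
  algebra₁ : ∀ W n k ρ → 1ℚ - W * ((n - k) * ρ) ≡ (1ℚ - W) + W * ((1ℚ + (k + k)) * ρ) + W * (1ℚ - ρ * (1ℚ + (n + k)))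
  algebra₁ = solve-∀ ℚ-ring
  algebra₂ : ∀ W k ρ → (1ℚ - W) + W * ((1ℚ + (k + k)) * ρ) + W * (1ℚ - 1ℚ) ≡ (1ℚ - W) + W * ((1ℚ + (k + k)) * ρ)
  algebra₂ = solve-∀ ℚ-ring

w-bounds : ∀ N m → m ℕ.≤ N → 0ℚ ≤ w N m ∧ w N m ≤ 1ℚ ∧ (1ℚ - w N m) * ι N ≤ ι m * ι m
w-bounds N zero _ = 0≤1 , ≤-refl , ≤-reflexive (algebra (ι N))
  where
  algebra : ∀ n → (1ℚ - 1ℚ) * n ≡ 0ℚ * 0ℚ
  algebra = solve-∀ ℚ-ring
w-bounds N (suc m) m<N with w-bounds N m (ℕₚ.<⇒≤ m<N)
... | 0≤W , W≤1 , bound = 0≤W' , W'≤1 , bound'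
  where
  open ≤-Reasoning
  W = w N m
  n = ι N
  k = ι m
  ρ = inv (N ℕ.+ m) 1
  0≤ρ = 0≤inv (N ℕ.+ m) 1
  0≤1+2k : 0ℚ ≤ 1ℚ + (k + k)
  0≤1+2k = +-nonNeg 0≤1 (+-nonNeg (0≤ι m) (0≤ι m))
  n-k≡ι[N∸m] : n - k ≡ ι (N ℕ.∸ m)
  n-k≡ι[N∸m] = trans (cong (_- k) (ι-∸ (ℕₚ.<⇒≤ m<N))) (algebra k (ι (N ℕ.∸ m)))
    where
    algebra : ∀ k d → (k + d) - k ≡ d
    algebra = solve-∀ ℚ-ring
  0≤W' : 0ℚ ≤ w N (suc m)
  0≤W' = *-nonNeg 0≤W (subst (λ z → 0ℚ ≤ z * ρ) (sym n-k≡ι[N∸m]) (*-nonNeg (0≤ι (N ℕ.∸ m)) 0≤ρ))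
  W'≤1 : w N (suc m) ≤ 1ℚ
  W'≤1 = 0≤q-p⇒p≤q (subst (0ℚ ≤_) (sym (1-w-suc N m))
    (+-nonNeg (p≤q⇒0≤q-p W≤1) (*-nonNeg 0≤W (*-nonNeg 0≤1+2k 0≤ρ))))
  bound' : (1ℚ - w N (suc m)) * n ≤ ι (suc m) * ι (suc m)
  bound' = begin
    (1ℚ - w N (suc m)) * n                        ≡⟨ cong (_* n) (1-w-suc N m) ⟩
    ((1ℚ - W) + W * ((1ℚ + (k + k)) * ρ)) * n     ≡⟨ algebra₁ W k ρ n ⟩
    (1ℚ - W) * n + W * ((1ℚ + (k + k)) * (ρ * n)) ≤⟨ +-mono-≤ bound
      (*-mono-≤-nonNeg 0≤W (*-nonNeg 0≤1+2k (*-nonNeg 0≤ρ (0≤ι N))) W≤1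
        (*-monoˡ-≤-nonNeg (1ℚ + (k + k)) {{nonNegative 0≤1+2k}} (inv-1-*-ι≤1 (N ℕ.+ m) (ℕₚ.m≤n⇒m≤1+n (ℕₚ.m≤m+n N m))))) ⟩
    k * k + 1ℚ * ((1ℚ + (k + k)) * 1ℚ)            ≡⟨ algebra₂ k ⟩
    (1ℚ + k) * (1ℚ + k)                           ∎
    where
    algebra₁ : ∀ W k ρ n → ((1ℚ - W) + W * ((1ℚ + (k + k)) * ρ)) * n ≡ (1ℚ - W) * n + W * ((1ℚ + (k + k)) * (ρ * n))
    algebra₁ = solve-∀ ℚ-ring
    algebra₂ : ∀ k → k * k + 1ℚ * ((1ℚ + (k + k)) * 1ℚ) ≡ (1ℚ + k) * (1ℚ + k)
    algebra₂ = solve-∀ ℚ-ring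

-- Junk value at []: the indices p are never empty.
Hᵂ : ℕ → List ℕ → ℚ
Hᵂ N [] = 0ℚ
Hᵂ N (s ∷ q) = ∑[ i < N ] (w N (suc i) * (inv i s * H i q))

Hᵂ-zero : ∀ p → Hᵂ 0 p ≡ 0ℚ
Hᵂ-zero [] = refl
Hᵂ-zero (s ∷ q) = refl

Hᵂ-suc : ∀ n e q → Hᵂ (suc n) (e ∷ q) ≡
  Hᵂ n (e ∷ q) + inv n 2 * ∑[ i < suc n ] (w (suc n) (suc i) * (ι (suc i) * ι (suc i)) * (inv i e * H i q))
Hᵂ-suc n e q = begin
  ∑[ i < suc n ] (w (suc n) (suc i) * a i)
    ≡⟨ ∑-cong (suc n) (λ i → trans (cong (_* a i) (w-suc n (suc i))) (algebra (w n (suc i)) X (w (suc n) (suc i)) (k² i) (a i))) ⟩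
  ∑[ i < suc n ] (w n (suc i) * a i + X * (w (suc n) (suc i) * k² i * a i))
    ≡⟨ ∑-+ (suc n) (λ i → w n (suc i) * a i) (λ i → X * (w (suc n) (suc i) * k² i * a i)) ⟩
  ∑[ i < suc n ] (w n (suc i) * a i) + ∑[ i < suc n ] (X * (w (suc n) (suc i) * k² i * a i))
    ≡⟨ cong₂ _+_ dropLast (∑-*ˡ (suc n) X (λ i → w (suc n) (suc i) * k² i * a i)) ⟩
  Hᵂ n (e ∷ q) + X * ∑[ i < suc n ] (w (suc n) (suc i) * k² i * a i) ∎
  where
  open ≡-Reasoning
  X = inv n 2
  a k² : ℕ → ℚ
  a i = inv i e * H i q
  k² i = ι (suc i) * ι (suc i)
  algebra : ∀ W X W' k² a → (W + X * (W' * k²)) * a ≡ W * a + X * (W' * k² * a)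
  algebra = solve-∀ ℚ-ring
  dropLast : w n (suc n) * a n + Hᵂ n (e ∷ q) ≡ Hᵂ n (e ∷ q)
  dropLast = trans (cong (λ z → z * a n + Hᵂ n (e ∷ q)) (w-vanishes n))
    (trans (cong (_+ Hᵂ n (e ∷ q)) (*-zeroˡ (a n))) (+-identityˡ (Hᵂ n (e ∷ q))))

Hᵂ-step-2 : ∀ n e q → Hᵂ (suc n) ((e ℕ.+ 2) ∷ q) ≡ inv n 2 * Hᵂ (suc n) (e ∷ q) + Hᵂ n ((e ℕ.+ 2) ∷ q)
Hᵂ-step-2 n e q = begin
  Hᵂ (suc n) ((e ℕ.+ 2) ∷ q)
    ≡⟨ Hᵂ-suc n (e ℕ.+ 2) q ⟩
  Hᵂ n ((e ℕ.+ 2) ∷ q) + inv n 2 * ∑[ i < suc n ] (w (suc n) (suc i) * (ι (suc i) * ι (suc i)) * (inv i (e ℕ.+ 2) * H i q))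
    ≡⟨ cong (λ z → Hᵂ n ((e ℕ.+ 2) ∷ q) + inv n 2 * z) (∑-cong (suc n) shift) ⟩
  Hᵂ n ((e ℕ.+ 2) ∷ q) + inv n 2 * Hᵂ (suc n) (e ∷ q)
    ≡⟨ +-comm (Hᵂ n ((e ℕ.+ 2) ∷ q)) (inv n 2 * Hᵂ (suc n) (e ∷ q)) ⟩
  inv n 2 * Hᵂ (suc n) (e ∷ q) + Hᵂ n ((e ℕ.+ 2) ∷ q) ∎
  where
  open ≡-Reasoning
  algebra : ∀ W k² a h → W * k² * (a * h) ≡ W * ((k² * a) * h)
  algebra = solve-∀ ℚ-ring
  shift : ∀ i → w (suc n) (suc i) * (ι (suc i) * ι (suc i)) * (inv i (e ℕ.+ 2) * H i q) ≡ w (suc n) (suc i) * (inv i e * H i q)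
  shift i = trans (algebra (w (suc n) (suc i)) (ι (suc i) * ι (suc i)) (inv i (e ℕ.+ 2)) (H i q))
    (cong (λ z → w (suc n) (suc i) * (z * H i q)) (inv-shift i e))

k²-*-inv-1 : ∀ W i y → W * (ι (suc i) * ι (suc i)) * (inv i 1 * y) ≡ ι (suc i) * W * y
k²-*-inv-1 W i y = begin
  W * (k * k) * (inv i 1 * y)   ≡⟨ algebra W k (inv i 1) y ⟩
  k * W * y * (inv i 1 * k)     ≡⟨ cong (k * W * y *_) (inv-1 i) ⟩
  k * W * y * 1ℚ                ≡⟨ *-identityʳ (k * W * y) ⟩
  k * W * y                     ∎
  where
  open ≡-Reasoning
  k = ι (suc i)
  algebra : ∀ W k ρ y → W * (k * k) * (ρ * y) ≡ k * W * y * (ρ * k)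
  algebra = solve-∀ ℚ-ring

Hᵂ-step-1-[] : ∀ n → ι 2 * Hᵂ (suc n) [ 1 ] ≡ inv n 1 + ι 2 * Hᵂ n [ 1 ]
Hᵂ-step-1-[] n = begin
  ι 2 * Hᵂ (suc n) [ 1 ]                  ≡⟨ cong (ι 2 *_) (Hᵂ-suc n 1 []) ⟩
  ι 2 * (Hᵂ n [ 1 ] + X * ∑< (suc n) b)   ≡⟨ algebra (Hᵂ n [ 1 ]) X (∑< (suc n) b) ⟩
  X * (ι 2 * ∑< (suc n) b) + ι 2 * Hᵂ n [ 1 ]
    ≡⟨ cong (λ z → X * z + ι 2 * Hᵂ n [ 1 ]) (trans (sym (∑-*ˡ (suc n) (ι 2) b))
         (trans (∑-cong (suc n) (λ i → cong (ι 2 *_) (k²-*-inv-1 (w (suc n) (suc i)) i 1ℚ)))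
           (trans (∑-cong (suc n) (λ i → cong (ι 2 *_) (*-identityʳ (ι (suc i) * w (suc n) (suc i))))) (∑-weighted-moment (suc n))))) ⟩
  X * ι (suc n) + ι 2 * Hᵂ n [ 1 ]        ≡⟨ cong (_+ ι 2 * Hᵂ n [ 1 ]) (inv-2-*-ι n) ⟩
  inv n 1 + ι 2 * Hᵂ n [ 1 ]              ∎
  where
  open ≡-Reasoning
  X = inv n 2
  b : ℕ → ℚ
  b i = w (suc n) (suc i) * (ι (suc i) * ι (suc i)) * (inv i 1 * 1ℚ)
  algebra : ∀ A X S → ι 2 * (A + X * S) ≡ X * (ι 2 * S) + ι 2 * A
  algebra = solve-∀ ℚ-ring

Hᵂ-step-1 : ∀ n x q →
  ι 2 * Hᵂ (suc n) (1 ∷ x ∷ q) + Hᵂ (suc n) ((1 ℕ.+ x) ∷ q)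
    ≡ inv n 1 * Hᵂ (suc n) (x ∷ q) + (ι 2 * Hᵂ n (1 ∷ x ∷ q) + Hᵂ n ((1 ℕ.+ x) ∷ q))
Hᵂ-step-1 n x q = begin
  ι 2 * Hᵂ N' (1 ∷ x ∷ q) + Hᵂ N' ((1 ℕ.+ x) ∷ q)
    ≡⟨ cong₂ (λ u v → ι 2 * u + v) (Hᵂ-suc n 1 (x ∷ q)) (Hᵂ-suc n (1 ℕ.+ x) q) ⟩
  ι 2 * (A₁ + X * ∑< N' b₁) + (A₂ + X * ∑< N' b₂)
    ≡⟨ algebra A₁ A₂ X (∑< N' b₁) (∑< N' b₂) ⟩
  X * (ι 2 * ∑< N' b₁ + ∑< N' b₂) + (ι 2 * A₁ + A₂)
    ≡⟨ cong₂ (λ u v → X * (ι 2 * u + v) + (ι 2 * A₁ + A₂)) (∑-cong N' b₁≡) (∑-cong N' b₂≡) ⟩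
  X * (ι 2 * ∑[ i < N' ] (ι (suc i) * w N' (suc i) * ∑< i g) + ∑[ i < N' ] (ι (suc i) * w N' (suc i) * g i)) + (ι 2 * A₁ + A₂)
    ≡⟨ cong (λ z → X * z + (ι 2 * A₁ + A₂)) (∑-weighted-by-parts N' g) ⟩
  X * (ι N' * Hᵂ N' (x ∷ q)) + (ι 2 * A₁ + A₂)
    ≡⟨ cong (_+ (ι 2 * A₁ + A₂)) (trans (sym (*-assoc X (ι N') (Hᵂ N' (x ∷ q)))) (cong (_* Hᵂ N' (x ∷ q)) (inv-2-*-ι n))) ⟩
  inv n 1 * Hᵂ N' (x ∷ q) + (ι 2 * A₁ + A₂) ∎
  where
  open ≡-Reasoning
  N' = suc n
  X = inv n 2
  A₁ = Hᵂ n (1 ∷ x ∷ q)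
  A₂ = Hᵂ n ((1 ℕ.+ x) ∷ q)
  g b₁ b₂ : ℕ → ℚ
  g i = inv i x * H i q
  b₁ i = w N' (suc i) * (ι (suc i) * ι (suc i)) * (inv i 1 * H i (x ∷ q))
  b₂ i = w N' (suc i) * (ι (suc i) * ι (suc i)) * (inv i (1 ℕ.+ x) * H i q)
  b₁≡ : ∀ i → b₁ i ≡ ι (suc i) * w N' (suc i) * ∑< i g
  b₁≡ i = trans (k²-*-inv-1 (w N' (suc i)) i (H i (x ∷ q))) (cong (ι (suc i) * w N' (suc i) *_) (H-unfold i x q))
  b₂≡ : ∀ i → b₂ i ≡ ι (suc i) * w N' (suc i) * g i
  b₂≡ i = trans (cong (λ z → w N' (suc i) * (ι (suc i) * ι (suc i)) * (z * H i q)) (inv-+ i 1 x))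
    (trans (cong (w N' (suc i) * (ι (suc i) * ι (suc i)) *_) (*-assoc (inv i 1) (inv i x) (H i q)))
      (k²-*-inv-1 (w N' (suc i)) i (g i)))
  algebra : ∀ A₁ A₂ X S₁ S₂ → ι 2 * (A₁ + X * S₁) + (A₂ + X * S₂) ≡ X * (ι 2 * S₁ + S₂) + (ι 2 * A₁ + A₂)
  algebra = solve-∀ ℚ-ring

D : ℕ → ℕ → List ℕ → ℚ
D n s q = ∑[ i < n ] ((1ℚ - w n (suc i)) * (inv i s * H i q))

H-Hᵂ≡D : ∀ n s q → H n (s ∷ q) - Hᵂ n (s ∷ q) ≡ D n s q
H-Hᵂ≡D n s q = begin
  H n (s ∷ q) - Hᵂ n (s ∷ q)                        ≡⟨ cong (_- Hᵂ n (s ∷ q)) (H-unfold n s q) ⟩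
  ∑< n a - ∑[ i < n ] (w n (suc i) * a i)           ≡⟨ sym (∑-- n a (λ i → w n (suc i) * a i)) ⟩
  ∑[ i < n ] (a i - w n (suc i) * a i)              ≡⟨ ∑-cong n (λ i → algebra (w n (suc i)) (a i)) ⟩
  D n s q                                           ∎
  where
  open ≡-Reasoning
  a : ℕ → ℚ
  a i = inv i s * H i q
  algebra : ∀ W a → a - W * a ≡ (1ℚ - W) * a
  algebra = solve-∀ ℚ-ring

0≤D : ∀ n s q → 0ℚ ≤ D n s q
0≤D n s q = ∑-nonNeg n _ λ i i<n →
  *-nonNeg (p≤q⇒0≤q-p (proj₁ (proj₂ (w-bounds n (suc i) i<n)))) (*-nonNeg (0≤inv i s) (0≤H i q))

ι*D≤H : ∀ n s q → 1 ℕ.≤ s → ι n * D n (s ℕ.+ 2) q ≤ H n (1 ∷ q)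
ι*D≤H n s q 1≤s = begin
  ι n * D n (s ℕ.+ 2) q                 ≡⟨ sym (∑-*ˡ n (ι n) _) ⟩
  ∑[ i < n ] (ι n * e i)                ≤⟨ ∑-mono-≤ n _ _ term ⟩
  ∑[ i < n ] (inv i 1 * H i q)          ≡⟨ sym (H-unfold n 1 q) ⟩
  H n (1 ∷ q)                           ∎
  where
  open ≤-Reasoning
  e : ℕ → ℚ
  e i = (1ℚ - w n (suc i)) * (inv i (s ℕ.+ 2) * H i q)
  algebra : ∀ n u a h → n * (u * (a * h)) ≡ (u * n) * (a * h)
  algebra = solve-∀ ℚ-ring
  term : ∀ i → i ℕ.< n → ι n * e i ≤ inv i 1 * H i q
  term i i<n = begin
    ι n * e i                                               ≡⟨ algebra (ι n) (1ℚ - w n (suc i)) (inv i (s ℕ.+ 2)) (H i q) ⟩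
    ((1ℚ - w n (suc i)) * ι n) * (inv i (s ℕ.+ 2) * H i q)  ≤⟨ *-monoʳ-≤-nonNeg (inv i (s ℕ.+ 2) * H i q)
                                                                 {{nonNegative (*-nonNeg (0≤inv i (s ℕ.+ 2)) (0≤H i q))}}
                                                                 (proj₂ (proj₂ (w-bounds n (suc i) i<n))) ⟩
    (ι (suc i) * ι (suc i)) * (inv i (s ℕ.+ 2) * H i q)     ≡⟨ sym (*-assoc (ι (suc i) * ι (suc i)) (inv i (s ℕ.+ 2)) (H i q)) ⟩
    (ι (suc i) * ι (suc i)) * inv i (s ℕ.+ 2) * H i q       ≡⟨ cong (_* H i q) (inv-shift i s) ⟩
    inv i s * H i q                                         ≤⟨ *-monoʳ-≤-nonNeg (H i q) {{nonNegative (0≤H i q)}} (inv-antitone i 1≤s) ⟩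
    inv i 1 * H i q                                         ∎

addHead : ℕ → List ℕ → List ℕ
addHead c [] = []
addHead c (x ∷ q) = (c ℕ.+ x) ∷ q

depth-addHead : ∀ c q → depth (addHead c q) ≡ depth q
depth-addHead c [] = refl
depth-addHead c (x ∷ q) = refl

glue-+ : ∀ c d zs → glue (c ℕ.+ d) zs ≡ addHead c (glue d zs)
glue-+ c d [] = refl
glue-+ c d ((true , b) ∷ zs) = trans (cong (λ z → glue z zs) (ℕₚ.+-assoc c d b)) (glue-+ c (d ℕ.+ b) zs)
glue-+ c d ((false , b) ∷ zs) = refl

Hᵂ-step-2-addHead : ∀ n c q →
  Hᵂ (suc n) (addHead (c ℕ.+ 2) q) ≡ inv n 2 * Hᵂ (suc n) (addHead c q) + Hᵂ n (addHead (c ℕ.+ 2) q)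
Hᵂ-step-2-addHead n c [] = sym (trans (cong (_+ 0ℚ) (*-zeroʳ (inv n 2))) (+-identityʳ 0ℚ))
Hᵂ-step-2-addHead n c (x ∷ q) =
  subst (λ y → Hᵂ (suc n) (y ∷ q) ≡ inv n 2 * Hᵂ (suc n) ((c ℕ.+ x) ∷ q) + Hᵂ n (y ∷ q)) (sym c+2+x≡c+x+2)
    (Hᵂ-step-2 n (c ℕ.+ x) q)
  where
  c+2+x≡c+x+2 : c ℕ.+ 2 ℕ.+ x ≡ c ℕ.+ x ℕ.+ 2
  c+2+x≡c+x+2 = trans (ℕₚ.+-assoc c 2 x) (trans (cong (c ℕ.+_) (ℕₚ.+-comm 2 x)) (sym (ℕₚ.+-assoc c x 2)))

odd-suc : ∀ a → odd (suc a) ≡ odd a ℕ.+ 2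
odd-suc a = trans (cong (ℕ._+ 1) (ℕₚ.*-distribˡ-+ 2 1 a)) (ℕₚ.+-comm 2 (odd a))

1≤odd : ∀ b → 1 ℕ.≤ odd b
1≤odd b = ℕₚ.m≤n+m 1 (2 ℕ.* b)

record Shape (c k : ℕ) (p : List ℕ) : Set where
  constructor shape
  field
    x : ℕ
    q : List ℕ
    p≡x∷q : p ≡ x ∷ q
    c≤x : c ℕ.≤ x
    q⁺ : All (1 ℕ.≤_) q
    length-q≤k : length q ℕ.≤ k

glue-shape : ∀ c (l : List Bool) bs → 1 ℕ.≤ c → Shape c (length bs) (glue c (zip l (map odd bs)))
glue-shape c [] bs _ = shape c [] refl ℕₚ.≤-refl [] z≤n
glue-shape c (_ ∷ l) [] _ = shape c [] refl ℕₚ.≤-refl [] z≤n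
glue-shape c (true ∷ l) (b ∷ bs) 1≤c with glue-shape (c ℕ.+ odd b) l bs (ℕₚ.≤-trans 1≤c (ℕₚ.m≤m+n c (odd b)))
... | shape x q p≡ c≤x q⁺ len = shape x q p≡ (ℕₚ.≤-trans (ℕₚ.m≤m+n c (odd b)) c≤x) q⁺ (ℕₚ.m≤n⇒m≤1+n len)
glue-shape c (false ∷ l) (b ∷ bs) 1≤c with glue-shape (odd b) l bs (1≤odd b)
... | shape x q p≡ b≤x q⁺ len = shape c (glue (odd b) (zip l (map odd bs))) refl ℕₚ.≤-refl
  (subst (All (1 ℕ.≤_)) (sym p≡) (ℕₚ.≤-trans (1≤odd b) b≤x ∷ q⁺)) (subst (λ z → length z ℕ.≤ suc (length bs)) (sym p≡) (s≤s len))

pIndex-shape : ∀ a as o → Shape (odd a) (length as) (pIndex a as o)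
pIndex-shape a as o = glue-shape (odd a) (Vec.toList o) as (1≤odd a)

coef : List ℕ → ℚ
coef p = (ℤ.+ (2 ℕ.^ depth p)) / 1

coef≡ι : ∀ p → coef p ≡ ι (2 ℕ.^ depth p)
coef≡ι p = n/1≡ι (2 ℕ.^ depth p)

coef-∷ : ∀ x p → coef (x ∷ p) ≡ ι 2 * coef p
coef-∷ x p = trans (coef≡ι (x ∷ p)) (trans (ι-* 2 (2 ℕ.^ depth p)) (cong (ι 2 *_) (sym (coef≡ι p))))

coef-addHead : ∀ c p → coef (addHead c p) ≡ coef p
coef-addHead c p = cong (λ d → (ℤ.+ (2 ℕ.^ d)) / 1) (depth-addHead c p)

length-allVecs : ∀ k → length (allVecs k) ≡ 2 ℕ.^ k
length-allVecs zero = refl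
length-allVecs (suc k) = trans (length-pairs (allVecs k)) (cong (λ m → m ℕ.+ (m ℕ.+ 0)) (length-allVecs k))
  where
  length-pairs : ∀ (L : List (Vec Bool k)) →
    length (concatMap (λ v → (true Vec.∷ v) ∷ (false Vec.∷ v) ∷ []) L) ≡ length L ℕ.+ (length L ℕ.+ 0)
  length-pairs [] = refl
  length-pairs (v ∷ L) = cong suc (trans (cong suc (length-pairs L)) (sym (ℕₚ.+-suc (length L) (length L ℕ.+ 0))))

-- rhs (H n) a as is rhsPartial n a as.
rhs : (List ℕ → ℚ) → ℕ → List ℕ → ℚ
rhs F a as = sumℚ (map (λ o → coef (pIndex a as o) * F (pIndex a as o)) (allVecs (length as)))

-- rhs F a (b ∷ bs) grouped by the first symbol: "," gives (e, p′) with one more part, "+" gives e + p′.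
rhs∘ : (List ℕ → ℚ) → ℕ → ℕ → List ℕ → ℚ
rhs∘ F e b bs = sumℚ (map (λ v → coef (pIndex b bs v) * (ι 2 * F (e ∷ pIndex b bs v) + F (addHead e (pIndex b bs v))))
                          (allVecs (length bs)))

rhs-∷ : ∀ F a b bs → rhs F a (b ∷ bs) ≡ rhs∘ F (odd a) b bs
rhs-∷ F a b bs = trans (sumℚ-map-pairs (λ o → coef (pIndex a (b ∷ bs) o) * F (pIndex a (b ∷ bs) o)) (true Vec.∷_) (false Vec.∷_) L)
  (sumℚ-map-cong L λ v → begin
    coef (glue (odd a ℕ.+ odd b) (zs v)) * F (glue (odd a ℕ.+ odd b) (zs v)) + coef (odd a ∷ q v) * F (odd a ∷ q v)
      ≡⟨ cong₂ (λ u y → coef u * F u + y * F (odd a ∷ q v)) (glue-+ (odd a) (odd b) (zs v)) (coef-∷ (odd a) (q v)) ⟩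
    coef (addHead (odd a) (q v)) * F (addHead (odd a) (q v)) + ι 2 * coef (q v) * F (odd a ∷ q v)
      ≡⟨ cong (λ y → y * F (addHead (odd a) (q v)) + ι 2 * coef (q v) * F (odd a ∷ q v)) (coef-addHead (odd a) (q v)) ⟩
    coef (q v) * F (addHead (odd a) (q v)) + ι 2 * coef (q v) * F (odd a ∷ q v)
      ≡⟨ algebra (ι 2) (coef (q v)) (F (addHead (odd a) (q v))) (F (odd a ∷ q v)) ⟩
    coef (q v) * (ι 2 * F (odd a ∷ q v) + F (addHead (odd a) (q v))) ∎)
  where
  open ≡-Reasoning
  L = allVecs (length bs)
  q : Vec Bool (length bs) → List ℕ
  q v = pIndex b bs v
  zs : Vec Bool (length bs) → List (Bool ∧ ℕ)
  zs v = zip (Vec.toList v) (map odd bs)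
  algebra : ∀ t c A B → c * A + t * c * B ≡ c * (t * B + A)
  algebra = solve-∀ ℚ-ring

rhs∘-Hᵂ-zero : ∀ e b bs → rhs∘ (Hᵂ 0) e b bs ≡ 0ℚ
rhs∘-Hᵂ-zero e b bs = sumℚ-map-zero _ (allVecs (length bs)) λ v →
  trans (cong₂ (λ u y → coef (q v) * (ι 2 * u + y)) (Hᵂ-zero (e ∷ q v)) (Hᵂ-zero (addHead e (q v)))) (algebra (ι 2) (coef (q v)))
  where
  q : Vec Bool (length bs) → List ℕ
  q v = pIndex b bs v
  algebra : ∀ t c → c * (t * 0ℚ + 0ℚ) ≡ 0ℚ
  algebra = solve-∀ ℚ-ring

rhs∘-Hᵂ-step-2 : ∀ n e b bs →
  rhs∘ (Hᵂ (suc n)) (e ℕ.+ 2) b bs ≡ inv n 2 * rhs∘ (Hᵂ (suc n)) e b bs + rhs∘ (Hᵂ n) (e ℕ.+ 2) b bs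
rhs∘-Hᵂ-step-2 n e b bs = sumℚ-map-affine (inv n 2) _ _ _ (allVecs (length bs)) λ v →
  trans (cong₂ (λ u y → coef (q v) * (ι 2 * u + y)) (Hᵂ-step-2 n e (q v)) (Hᵂ-step-2-addHead n e (q v)))
    (algebra (ι 2) (coef (q v)) (inv n 2) (Hᵂ (suc n) (e ∷ q v)) (Hᵂ (suc n) (addHead e (q v)))
      (Hᵂ n ((e ℕ.+ 2) ∷ q v)) (Hᵂ n (addHead (e ℕ.+ 2) (q v))))
  where
  q : Vec Bool (length bs) → List ℕ
  q v = pIndex b bs v
  algebra : ∀ t c X A B C D → c * (t * (X * A + C) + (X * B + D)) ≡ X * (c * (t * A + B)) + c * (t * C + D)
  algebra = solve-∀ ℚ-ring

rhs∘-Hᵂ-step-1 : ∀ n b bs → rhs∘ (Hᵂ (suc n)) 1 b bs ≡ inv n 1 * rhs (Hᵂ (suc n)) b bs + rhs∘ (Hᵂ n) 1 b bs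
rhs∘-Hᵂ-step-1 n b bs = sumℚ-map-affine (inv n 1) _ _ _ (allVecs (length bs)) λ v → step (pIndex b bs v) (pIndex-shape b bs v)
  where
  algebra : ∀ t c X A B C → c * (X * A + (t * B + C)) ≡ X * (c * A) + c * (t * B + C)
  algebra = solve-∀ ℚ-ring
  step : ∀ p → Shape (odd b) (length bs) p →
    coef p * (ι 2 * Hᵂ (suc n) (1 ∷ p) + Hᵂ (suc n) (addHead 1 p))
      ≡ inv n 1 * (coef p * Hᵂ (suc n) p) + coef p * (ι 2 * Hᵂ n (1 ∷ p) + Hᵂ n (addHead 1 p))
  step .(x ∷ q) (shape x q refl _ _ _) = trans (cong (coef (x ∷ q) *_) (Hᵂ-step-1 n x q))
    (algebra (ι 2) (coef (x ∷ q)) (inv n 1) (Hᵂ (suc n) (x ∷ q)) (Hᵂ n (1 ∷ x ∷ q)) (Hᵂ n ((1 ℕ.+ x) ∷ q)))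

-- The exact identity

Hstar-2ᵃ-1-unique : (R : List ℕ) (T : ℕ → ℕ → ℚ) →
  (∀ a → T a 0 ≡ 0ℚ) →
  (∀ a n → T (suc a) (suc n) ≡ inv n 2 * T a (suc n) + T (suc a) n) →
  (∀ n → T 0 (suc n) ≡ inv n 1 * Hstar (suc n) R + T 0 n) →
  ∀ a N → Hstar N (replicate a 2 ++ 1 ∷ R) ≡ T a N
Hstar-2ᵃ-1-unique R T T-0 T-2 T-1 = go
  where
  go : ∀ a N → Hstar N (replicate a 2 ++ 1 ∷ R) ≡ T a N
  go zero zero = sym (T-0 zero)
  go (suc a) zero = sym (T-0 (suc a))
  go zero (suc n) = trans (cong (inv n 1 * Hstar (suc n) R +_) (go zero n)) (sym (T-1 n))
  go (suc a) (suc n) = trans (cong₂ (λ u v → inv n 2 * u + v) (go a (suc n)) (go (suc a) n)) (sym (T-2 a n))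

Hstar≡rhs-Hᵂ : ∀ a as N → Hstar N (starIndex (a ∷ as)) ≡ rhs (Hᵂ N) a as
Hstar≡rhs-Hᵂ a [] N = begin
  Hstar N ((replicate a 2 ++ [ 1 ]) ++ [])   ≡⟨ cong (Hstar N) (Listₚ.++-identityʳ (replicate a 2 ++ [ 1 ])) ⟩
  Hstar N (replicate a 2 ++ [ 1 ])           ≡⟨ Hstar-2ᵃ-1-unique [] T T-0 T-2 T-1 a N ⟩
  ι 2 * Hᵂ N [ odd a ]                       ≡⟨ sym (+-identityʳ _) ⟩
  rhs (Hᵂ N) a []                            ∎
  where
  open ≡-Reasoning
  T : ℕ → ℕ → ℚ
  T a N = ι 2 * Hᵂ N [ odd a ]
  T-0 : ∀ a → T a 0 ≡ 0ℚ
  T-0 a = *-zeroʳ (ι 2)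
  T-2 : ∀ a n → T (suc a) (suc n) ≡ inv n 2 * T a (suc n) + T (suc a) n
  T-2 a n = subst (λ e → ι 2 * Hᵂ (suc n) [ e ] ≡ inv n 2 * T a (suc n) + ι 2 * Hᵂ n [ e ]) (sym (odd-suc a))
    (trans (cong (ι 2 *_) (Hᵂ-step-2 n (odd a) []))
      (algebra (ι 2) (inv n 2) (Hᵂ (suc n) [ odd a ]) (Hᵂ n [ odd a ℕ.+ 2 ])))
    where
    algebra : ∀ c X A B → c * (X * A + B) ≡ X * (c * A) + c * B
    algebra = solve-∀ ℚ-ring
  T-1 : ∀ n → T 0 (suc n) ≡ inv n 1 * 1ℚ + T 0 n
  T-1 n = trans (Hᵂ-step-1-[] n) (cong (_+ T 0 n) (sym (*-identityʳ (inv n 1))))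
Hstar≡rhs-Hᵂ a (b ∷ bs) N = begin
  Hstar N ((replicate a 2 ++ [ 1 ]) ++ R)   ≡⟨ cong (Hstar N) (Listₚ.++-assoc (replicate a 2) [ 1 ] R) ⟩
  Hstar N (replicate a 2 ++ 1 ∷ R)          ≡⟨ Hstar-2ᵃ-1-unique R T T-0 T-2 T-1 a N ⟩
  rhs∘ (Hᵂ N) (odd a) b bs                  ≡⟨ sym (rhs-∷ (Hᵂ N) a b bs) ⟩
  rhs (Hᵂ N) a (b ∷ bs)                      ∎
  where
  open ≡-Reasoning
  R = starIndex (b ∷ bs)
  T : ℕ → ℕ → ℚ
  T a N = rhs∘ (Hᵂ N) (odd a) b bs
  T-0 : ∀ a → T a 0 ≡ 0ℚ
  T-0 a = rhs∘-Hᵂ-zero (odd a) b bs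
  T-2 : ∀ a n → T (suc a) (suc n) ≡ inv n 2 * T a (suc n) + T (suc a) n
  T-2 a n = subst (λ e → rhs∘ (Hᵂ (suc n)) e b bs ≡ inv n 2 * T a (suc n) + rhs∘ (Hᵂ n) e b bs) (sym (odd-suc a))
    (rhs∘-Hᵂ-step-2 n (odd a) b bs)
  T-1 : ∀ n → T 0 (suc n) ≡ inv n 1 * Hstar (suc n) R + T 0 n
  T-1 n = trans (rhs∘-Hᵂ-step-1 n b bs) (cong (λ z → inv n 1 * z + T 0 n) (sym (Hstar≡rhs-Hᵂ b bs (suc n))))

-- Bounding the error

0≤coef : ∀ p → 0ℚ ≤ coef p
0≤coef p = subst (0ℚ ≤_) (sym (coef≡ι p)) (0≤ι (2 ℕ.^ depth p))

coef≤ : ∀ p {k} → depth p ℕ.≤ k → coef p ≤ ι (2 ℕ.^ k)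
coef≤ p depth≤k = ≤-trans (≤-reflexive (coef≡ι p)) (ι-mono-≤ (ℕₚ.^-monoʳ-≤ 2 depth≤k))

harmonic^≤[1+harmonic]^ : ∀ n {d k} → d ℕ.≤ k → harmonic n ^ d ≤ (1ℚ + harmonic n) ^ k
harmonic^≤[1+harmonic]^ n {d} d≤k = ≤-trans (^-mono-≤ d (0≤harmonic n) (≤-by 1ℚ (algebra₁ (harmonic n)) 0≤1))
  (^-monoʳ-≤ (≤-by (harmonic n) (algebra₂ (harmonic n)) (0≤harmonic n)) d≤k)
  where
  algebra₁ : ∀ T → (1ℚ + T) - T ≡ 1ℚ
  algebra₁ = solve-∀ ℚ-ring
  algebra₂ : ∀ T → (1ℚ + T) - 1ℚ ≡ T
  algebra₂ = solve-∀ ℚ-ring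

3≤odd : ∀ {a} → 1 ℕ.≤ a → 3 ℕ.≤ odd a
3≤odd 1≤a = ℕₚ.+-monoˡ-≤ 1 (ℕₚ.*-monoʳ-≤ 2 1≤a)

0≤H-Hᵂ : ∀ n x q → 0ℚ ≤ H n (x ∷ q) - Hᵂ n (x ∷ q)
0≤H-Hᵂ n x q = subst (0ℚ ≤_) (sym (H-Hᵂ≡D n x q)) (0≤D n x q)

ι*[H-Hᵂ]≤harmonic^ : ∀ n x q → 3 ℕ.≤ x → All (1 ℕ.≤_) q →
  ι n * (H n (x ∷ q) - Hᵂ n (x ∷ q)) ≤ harmonic n ^ suc (length q)
ι*[H-Hᵂ]≤harmonic^ n x q 3≤x q⁺ = begin
  ι n * (H n (x ∷ q) - Hᵂ n (x ∷ q))   ≡⟨ cong (ι n *_) (trans (H-Hᵂ≡D n x q) (cong (λ y → D n y q) x≡s+2)) ⟩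
  ι n * D n (s ℕ.+ 2) q                ≤⟨ ι*D≤H n s q (ℕₚ.∸-monoˡ-≤ 2 3≤x) ⟩
  H n (1 ∷ q)                          ≤⟨ H≤harmonic^depth n (1 ∷ q) (s≤s z≤n ∷ q⁺) ⟩
  harmonic n ^ suc (length q)          ∎
  where
  open ≤-Reasoning
  s = x ℕ.∸ 2
  x≡s+2 : x ≡ s ℕ.+ 2
  x≡s+2 = sym (ℕₚ.m∸n+n≡m (ℕₚ.≤-trans (ℕₚ.n≤1+n 2) 3≤x))

index-error-bound : ∀ n a as o → 1 ℕ.≤ a →
  let p = pIndex a as o ; k = length as in
  0ℚ ≤ coef p * (H n p - Hᵂ n p) ∧
  ι n * (coef p * (H n p - Hᵂ n p)) ≤ ι (2 ℕ.^ suc k) * (1ℚ + harmonic n) ^ suc k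
index-error-bound n a as o 1≤a with pIndex a as o | pIndex-shape a as o
... | .(x ∷ q) | shape x q refl odd[a]≤x q⁺ len = *-nonNeg (0≤coef (x ∷ q)) (0≤H-Hᵂ n x q) , (begin
  ι n * (coef (x ∷ q) * e)               ≡⟨ algebra (ι n) (coef (x ∷ q)) e ⟩
  coef (x ∷ q) * (ι n * e)               ≤⟨ *-mono-≤-nonNeg (0≤coef (x ∷ q)) (*-nonNeg (0≤ι n) (0≤H-Hᵂ n x q)) (coef≤ (x ∷ q) (s≤s len))
                                              (≤-trans (ι*[H-Hᵂ]≤harmonic^ n x q (ℕₚ.≤-trans (3≤odd 1≤a) odd[a]≤x) q⁺)
                                                (harmonic^≤[1+harmonic]^ n (s≤s len))) ⟩
  ι (2 ℕ.^ suc (length as)) * (1ℚ + harmonic n) ^ suc (length as) ∎)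
  where
  open ≤-Reasoning
  e = H n (x ∷ q) - Hᵂ n (x ∷ q)
  algebra : ∀ n c e → n * (c * e) ≡ c * (n * e)
  algebra = solve-∀ ℚ-ring

ι*∣Hstar-rhsPartial∣≤ : ∀ n a as → 1 ℕ.≤ a → let k = length as in
  ι n * ∣ Hstar n (starIndex (a ∷ as)) - rhsPartial n a as ∣ ≤ ι (2 ℕ.^ k) * (ι (2 ℕ.^ suc k) * (1ℚ + harmonic n) ^ suc k)
ι*∣Hstar-rhsPartial∣≤ n a as 1≤a = begin
  ι n * ∣ Hstar n (starIndex (a ∷ as)) - rhsPartial n a as ∣   ≡⟨ cong (λ z → ι n * ∣ z - rhsPartial n a as ∣) (Hstar≡rhs-Hᵂ a as n) ⟩
  ι n * ∣ rhs (Hᵂ n) a as - rhs (H n) a as ∣                   ≡⟨ cong (λ z → ι n * ∣ z ∣) (algebra (rhs (Hᵂ n) a as) (rhs (H n) a as)) ⟩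
  ι n * ∣ - (rhs (H n) a as - rhs (Hᵂ n) a as) ∣               ≡⟨ cong (λ z → ι n * z) (∣-p∣≡∣p∣ _) ⟩
  ι n * ∣ rhs (H n) a as - rhs (Hᵂ n) a as ∣                   ≡⟨ cong (λ z → ι n * ∣ z ∣) rhs-rhs≡Φ ⟩
  ι n * ∣ Φ ∣                                                  ≡⟨ cong (ι n *_) (0≤p⇒∣p∣≡p 0≤Φ) ⟩
  ι n * Φ                                                      ≡⟨ sumℚ-map-*ˡ (ι n) e L ⟩
  sumℚ (map (λ o → ι n * e o) L)                               ≤⟨ sumℚ-map-≤ (λ o → ι n * e o) B L (λ o → proj₂ (index-error-bound n a as o 1≤a)) ⟩
  ι (length L) * B                                             ≡⟨ cong (λ m → ι m * B) (length-allVecs k) ⟩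
  ι (2 ℕ.^ k) * B                                              ∎
  where
  open ≤-Reasoning
  k = length as
  L = allVecs k
  p : Vec Bool k → List ℕ
  p o = pIndex a as o
  e : Vec Bool k → ℚ
  e o = coef (p o) * (H n (p o) - Hᵂ n (p o))
  Φ = sumℚ (map e L)
  B = ι (2 ℕ.^ suc k) * (1ℚ + harmonic n) ^ suc k
  algebra : ∀ x y → x - y ≡ - (y - x)
  algebra = solve-∀ ℚ-ring
  algebra₂ : ∀ c h h′ → c * h - c * h′ ≡ c * (h - h′)
  algebra₂ = solve-∀ ℚ-ring
  rhs-rhs≡Φ : rhs (H n) a as - rhs (Hᵂ n) a as ≡ Φ
  rhs-rhs≡Φ = trans (sumℚ-map-- _ _ L) (sumℚ-map-cong L λ o → algebra₂ (coef (p o)) (H n (p o)) (Hᵂ n (p o)))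
  0≤Φ : 0ℚ ≤ Φ
  0≤Φ = sumℚ-map-nonNeg e L (λ o → proj₁ (index-error-bound n a as o 1≤a))

ι*∣Hstar-rhsPartial∣≤ι : ∀ n t a as → 1 ℕ.≤ a → n ℕ.≤ 2 ℕ.^ t → let k = length as in
  ι n * ∣ Hstar n (starIndex (a ∷ as)) - rhsPartial n a as ∣ ≤ ι (2 ℕ.^ k ℕ.* 2 ℕ.^ suc k ℕ.* (2 ℕ.+ t) ℕ.^ suc k)
ι*∣Hstar-rhsPartial∣≤ι n t a as 1≤a n≤2^t = begin
  ι n * ∣ Hstar n (starIndex (a ∷ as)) - rhsPartial n a as ∣   ≤⟨ ι*∣Hstar-rhsPartial∣≤ n a as 1≤a ⟩
  ι (2 ℕ.^ k) * (ι (2 ℕ.^ r) * (1ℚ + harmonic n) ^ r)         ≤⟨ *-monoˡ-≤-nonNeg (ι (2 ℕ.^ k)) {{nonNegative (0≤ι (2 ℕ.^ k))}}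
                                                                   (*-monoˡ-≤-nonNeg (ι (2 ℕ.^ r)) {{nonNegative (0≤ι (2 ℕ.^ r))}}
                                                                     (^-mono-≤ r (+-nonNeg 0≤1 (0≤harmonic n)) 1+T≤ι[2+t])) ⟩
  ι (2 ℕ.^ k) * (ι (2 ℕ.^ r) * ι (2 ℕ.+ t) ^ r)               ≡⟨ sym (cong (λ z → ι (2 ℕ.^ k) * (ι (2 ℕ.^ r) * z)) (ι-^ (2 ℕ.+ t) r)) ⟩
  ι (2 ℕ.^ k) * (ι (2 ℕ.^ r) * ι ((2 ℕ.+ t) ℕ.^ r))           ≡⟨ sym ι[2^k*2^r*Y]≡ ⟩
  ι (2 ℕ.^ k ℕ.* 2 ℕ.^ r ℕ.* (2 ℕ.+ t) ℕ.^ r)                 ∎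
  where
  open ≤-Reasoning
  k = length as
  r = suc k
  Y = (2 ℕ.+ t) ℕ.^ r
  ι[2^k*2^r*Y]≡ : ι (2 ℕ.^ k ℕ.* 2 ℕ.^ r ℕ.* Y) ≡ ι (2 ℕ.^ k) * (ι (2 ℕ.^ r) * ι Y)
  ι[2^k*2^r*Y]≡ = trans (ι-* (2 ℕ.^ k ℕ.* 2 ℕ.^ r) Y)
    (trans (cong (_* ι Y) (ι-* (2 ℕ.^ k) (2 ℕ.^ r))) (*-assoc (ι (2 ℕ.^ k)) (ι (2 ℕ.^ r)) (ι Y)))
  1+T≤ι[2+t] : 1ℚ + harmonic n ≤ ι (2 ℕ.+ t)
  1+T≤ι[2+t] = +-monoʳ-≤ 1ℚ (≤-trans (harmonic-mono-≤ n≤2^t) (harmonic-2^ t))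

-- Exponentials dominate polynomials

^-distribʳ-* : ∀ m n k → (m ℕ.* n) ℕ.^ k ≡ m ℕ.^ k ℕ.* n ℕ.^ k
^-distribʳ-* m n zero = refl
^-distribʳ-* m n (suc k) = trans (cong (m ℕ.* n ℕ.*_) (^-distribʳ-* m n k)) (algebra m n (m ℕ.^ k) (n ℕ.^ k))
  where
  algebra : ∀ m n a b → m ℕ.* n ℕ.* (a ℕ.* b) ≡ m ℕ.* a ℕ.* (n ℕ.* b)
  algebra = solve-∀ ℕ-ring

ExpDominates : ℕ → Set
ExpDominates k = ∃ λ A → ∀ t → (2 ℕ.+ t) ℕ.^ k ℕ.≤ A ℕ.* 2 ℕ.^ t

2+t≤2*2^t : ∀ t → 2 ℕ.+ t ℕ.≤ 2 ℕ.* 2 ℕ.^ t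
2+t≤2*2^t zero = ℕₚ.≤-refl
2+t≤2*2^t (suc t) = ℕₚ.≤-trans (ℕₚ.m≤m+n (3 ℕ.+ t) (1 ℕ.+ t))
  (ℕₚ.≤-trans (ℕₚ.≤-reflexive (algebra t)) (ℕₚ.*-monoʳ-≤ 2 (2+t≤2*2^t t)))
  where
  algebra : ∀ t → (3 ℕ.+ t) ℕ.+ (1 ℕ.+ t) ≡ 2 ℕ.* (2 ℕ.+ t)
  algebra = solve-∀ ℕ-ring

halve : ∀ t → ∃ λ s → s ℕ.+ s ℕ.≤ t ∧ 2 ℕ.+ t ℕ.≤ 2 ℕ.* (2 ℕ.+ s)
halve zero = 0 , z≤n , s≤s (s≤s z≤n)
halve (suc zero) = 0 , z≤n , s≤s (s≤s (s≤s z≤n))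
halve (suc (suc t)) with halve t
... | s , s+s≤t , 2+t≤2[2+s] = suc s ,
  subst (ℕ._≤ suc (suc t)) (cong suc (sym (ℕₚ.+-suc s s))) (s≤s (s≤s s+s≤t)) ,
  subst (4 ℕ.+ t ℕ.≤_) (algebra s) (ℕₚ.+-monoʳ-≤ 2 2+t≤2[2+s])
  where
  algebra : ∀ s → 2 ℕ.+ 2 ℕ.* (2 ℕ.+ s) ≡ 2 ℕ.* (2 ℕ.+ (1 ℕ.+ s))
  algebra = solve-∀ ℕ-ring

expDominates-double : ∀ k → ExpDominates k → ExpDominates (k ℕ.+ k)
expDominates-double k (A , bound) = 2 ℕ.^ (k ℕ.+ k) ℕ.* (A ℕ.* A) , λ t → proof t (halve t)
  where
  open ℕₚ.≤-Reasoning
  c = 2 ℕ.^ (k ℕ.+ k)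
  algebra : ∀ c A x → c ℕ.* ((A ℕ.* x) ℕ.* (A ℕ.* x)) ≡ c ℕ.* (A ℕ.* A) ℕ.* (x ℕ.* x)
  algebra = solve-∀ ℕ-ring
  proof : ∀ t → (∃ λ s → s ℕ.+ s ℕ.≤ t ∧ 2 ℕ.+ t ℕ.≤ 2 ℕ.* (2 ℕ.+ s)) → (2 ℕ.+ t) ℕ.^ (k ℕ.+ k) ℕ.≤ c ℕ.* (A ℕ.* A) ℕ.* 2 ℕ.^ t
  proof t (s , s+s≤t , 2+t≤2[2+s]) = begin
    (2 ℕ.+ t) ℕ.^ (k ℕ.+ k)                       ≤⟨ ℕₚ.^-monoˡ-≤ (k ℕ.+ k) 2+t≤2[2+s] ⟩
    (2 ℕ.* (2 ℕ.+ s)) ℕ.^ (k ℕ.+ k)               ≡⟨ ^-distribʳ-* 2 (2 ℕ.+ s) (k ℕ.+ k) ⟩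
    c ℕ.* (2 ℕ.+ s) ℕ.^ (k ℕ.+ k)                 ≡⟨ cong (c ℕ.*_) (ℕₚ.^-distribˡ-+-* (2 ℕ.+ s) k k) ⟩
    c ℕ.* ((2 ℕ.+ s) ℕ.^ k ℕ.* (2 ℕ.+ s) ℕ.^ k)   ≤⟨ ℕₚ.*-monoʳ-≤ c (ℕₚ.*-mono-≤ (bound s) (bound s)) ⟩
    c ℕ.* ((A ℕ.* 2 ℕ.^ s) ℕ.* (A ℕ.* 2 ℕ.^ s))   ≡⟨ algebra c A (2 ℕ.^ s) ⟩
    c ℕ.* (A ℕ.* A) ℕ.* (2 ℕ.^ s ℕ.* 2 ℕ.^ s)     ≡⟨ cong (c ℕ.* (A ℕ.* A) ℕ.*_) (sym (ℕₚ.^-distribˡ-+-* 2 s s)) ⟩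
    c ℕ.* (A ℕ.* A) ℕ.* 2 ℕ.^ (s ℕ.+ s)           ≤⟨ ℕₚ.*-monoʳ-≤ (c ℕ.* (A ℕ.* A)) (ℕₚ.^-monoʳ-≤ 2 s+s≤t) ⟩
    c ℕ.* (A ℕ.* A) ℕ.* 2 ℕ.^ t                   ∎

expDominates-antitone : ∀ {k k′} → k ℕ.≤ k′ → ExpDominates k′ → ExpDominates k
expDominates-antitone {k} {k′} k≤k′ (A , bound) = A , λ t → ℕₚ.≤-trans (ℕₚ.^-monoʳ-≤ (2 ℕ.+ t) k≤k′) (bound t)

expDominates-2^ : ∀ j → ExpDominates (2 ℕ.^ j)
expDominates-2^ zero = 2 , λ t → subst (ℕ._≤ 2 ℕ.* 2 ℕ.^ t) (sym (ℕₚ.*-identityʳ (2 ℕ.+ t))) (2+t≤2*2^t t)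
expDominates-2^ (suc j) = subst ExpDominates (cong (2 ℕ.^ j ℕ.+_) (sym (ℕₚ.+-identityʳ (2 ℕ.^ j))))
  (expDominates-double (2 ℕ.^ j) (expDominates-2^ j))

n≤2^n : ∀ n → n ℕ.≤ 2 ℕ.^ n
n≤2^n zero = z≤n
n≤2^n (suc n) = ℕₚ.≤-trans (ℕₚ.+-mono-≤ (ℕₚ.m^n>0 2 n) (n≤2^n n)) (ℕₚ.≤-reflexive (cong (2 ℕ.^ n ℕ.+_) (sym (ℕₚ.+-identityʳ (2 ℕ.^ n)))))

expDominates : ∀ k → ExpDominates k
expDominates k = expDominates-antitone (n≤2^n k) (expDominates-2^ k)

eventually-C*poly≤2^ : ∀ C r → ∃ λ t₀ → ∀ t → t₀ ℕ.≤ t → C ℕ.* (2 ℕ.+ t) ℕ.^ r ℕ.≤ 2 ℕ.^ t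
eventually-C*poly≤2^ C r with expDominates (suc r)
... | A , bound = C ℕ.* A , λ t C*A≤t → ℕₚ.*-cancelʳ-≤ (C ℕ.* (2 ℕ.+ t) ℕ.^ r) (2 ℕ.^ t) (2 ℕ.+ t) (begin
    C ℕ.* (2 ℕ.+ t) ℕ.^ r ℕ.* (2 ℕ.+ t)   ≡⟨ algebra C ((2 ℕ.+ t) ℕ.^ r) (2 ℕ.+ t) ⟩
    C ℕ.* (2 ℕ.+ t) ℕ.^ suc r             ≤⟨ ℕₚ.*-monoʳ-≤ C (bound t) ⟩
    C ℕ.* (A ℕ.* 2 ℕ.^ t)                 ≡⟨ sym (ℕₚ.*-assoc C A (2 ℕ.^ t)) ⟩
    C ℕ.* A ℕ.* 2 ℕ.^ t                   ≤⟨ ℕₚ.*-monoˡ-≤ (2 ℕ.^ t) (ℕₚ.≤-trans C*A≤t (ℕₚ.m≤n+m t 2)) ⟩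
    (2 ℕ.+ t) ℕ.* 2 ℕ.^ t                 ≡⟨ ℕₚ.*-comm (2 ℕ.+ t) (2 ℕ.^ t) ⟩
    2 ℕ.^ t ℕ.* (2 ℕ.+ t)                 ∎)
  where
  open ℕₚ.≤-Reasoning
  algebra : ∀ C x y → C ℕ.* x ℕ.* y ≡ C ℕ.* (y ℕ.* x)
  algebra = solve-∀ ℕ-ring

2^-bracket : ∀ n → 1 ℕ.≤ n → ∃ λ t → n ℕ.≤ 2 ℕ.^ t ∧ 2 ℕ.^ t ℕ.≤ 2 ℕ.* n
2^-bracket (suc zero) _ = 0 , ℕₚ.≤-refl , s≤s z≤n
2^-bracket (suc (suc m)) _ with 2^-bracket (suc m) (s≤s z≤n)
... | t , 1+m≤2^t , 2^t≤2[1+m] with suc (suc m) ℕ.≤? 2 ℕ.^ t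
...   | yes 2+m≤2^t = t , 2+m≤2^t , ℕₚ.≤-trans 2^t≤2[1+m] (ℕₚ.*-monoʳ-≤ 2 (ℕₚ.n≤1+n (suc m)))
...   | no 2+m≰2^t = suc t ,
  ℕₚ.≤-trans (ℕₚ.+-monoʳ-≤ 2 (ℕₚ.m≤m+n m m)) (ℕₚ.≤-trans (ℕₚ.≤-reflexive (algebra m)) (ℕₚ.*-monoʳ-≤ 2 1+m≤2^t)) ,
  ℕₚ.*-monoʳ-≤ 2 (ℕₚ.≤-trans (ℕₚ.≤-pred (ℕₚ.≰⇒> 2+m≰2^t)) (ℕₚ.n≤1+n (suc m)))
  where
  algebra : ∀ m → 2 ℕ.+ (m ℕ.+ m) ≡ 2 ℕ.* (1 ℕ.+ m)
  algebra = solve-∀ ℕ-ring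

eventually-K*poly<n : ∀ K r → ∃ λ N → ∀ n → N ℕ.≤ n → ∃ λ t → n ℕ.≤ 2 ℕ.^ t ∧ K ℕ.* (2 ℕ.+ t) ℕ.^ r ℕ.< n
eventually-K*poly<n K r with eventually-C*poly≤2^ (2 ℕ.* K ℕ.+ 1) r
... | t₀ , bound = 2 ℕ.^ t₀ , λ n 2^t₀≤n → go n 2^t₀≤n (2^-bracket n (ℕₚ.≤-trans (ℕₚ.m^n>0 2 t₀) 2^t₀≤n))
  where
  go : ∀ n → 2 ℕ.^ t₀ ℕ.≤ n → (∃ λ t → n ℕ.≤ 2 ℕ.^ t ∧ 2 ℕ.^ t ℕ.≤ 2 ℕ.* n) →
       ∃ λ t → n ℕ.≤ 2 ℕ.^ t ∧ K ℕ.* (2 ℕ.+ t) ℕ.^ r ℕ.< n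
  go n 2^t₀≤n (t , n≤2^t , 2^t≤2n) = t , n≤2^t , ℕₚ.*-cancelˡ-< 2 (K ℕ.* Y) n (ℕₚ.<-≤-trans 2KY<[2K+1]Y
      (ℕₚ.≤-trans (bound t t₀≤t) 2^t≤2n))
    where
    Y = (2 ℕ.+ t) ℕ.^ r
    t₀≤t : t₀ ℕ.≤ t
    t₀≤t = ℕₚ.≮⇒≥ (λ t<t₀ → ℕₚ.<⇒≱ (ℕₚ.^-monoʳ-< 2 (s≤s (s≤s z≤n)) t<t₀) (ℕₚ.≤-trans 2^t₀≤n n≤2^t))
    algebra : ∀ K Y → 2 ℕ.* (K ℕ.* Y) ℕ.+ Y ≡ (2 ℕ.* K ℕ.+ 1) ℕ.* Y
    algebra = solve-∀ ℕ-ring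
    2KY<[2K+1]Y : 2 ℕ.* (K ℕ.* Y) ℕ.< (2 ℕ.* K ℕ.+ 1) ℕ.* Y
    2KY<[2K+1]Y = subst (2 ℕ.* (K ℕ.* Y) ℕ.<_) (algebra K Y) (ℕₚ.m<m+n (2 ℕ.* (K ℕ.* Y)) (ℕₚ.m^n>0 (2 ℕ.+ t) r))

theorem1p1 : (a₁ : ℕ) → a₁ ℕ.≥ 1 → (as : List ℕ) →
    (ε : ℚ) → 0ℚ < ε →
    ∃ λ N → (n : ℕ) → n ℕ.≥ N →
      ∣ Hstar n (starIndex (a₁ ∷ as)) - rhsPartial n a₁ as ∣ < ε
theorem1p1 a₁ 1≤a₁ as ε 0<ε with positive-as-fraction ε 0<ε
... | d , e , ε[1+d]≡1+e = proj₁ large , λ n N≤n → conclude n (proj₂ large n N≤n)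
  where
  k = length as
  K = 2 ℕ.^ k ℕ.* 2 ℕ.^ suc k
  large = eventually-K*poly<n (K ℕ.* suc d) (suc k)
  algebra : ∀ K D Y → K ℕ.* D ℕ.* Y ≡ K ℕ.* Y ℕ.* D
  algebra = solve-∀ ℕ-ring
  conclude : ∀ n → (∃ λ t → n ℕ.≤ 2 ℕ.^ t ∧ K ℕ.* suc d ℕ.* (2 ℕ.+ t) ℕ.^ suc k ℕ.< n) →
    ∣ Hstar n (starIndex (a₁ ∷ as)) - rhsPartial n a₁ as ∣ < ε
  conclude n (t , n≤2^t , KDY<n) = <-by-denominator n (K ℕ.* (2 ℕ.+ t) ℕ.^ suc k) d e ε[1+d]≡1+e (0≤∣p∣ _)
    (ι*∣Hstar-rhsPartial∣≤ι n t a₁ as 1≤a₁ n≤2^t) (subst (ℕ._< n) (algebra K (suc d) ((2 ℕ.+ t) ℕ.^ suc k)) KDY<n)
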